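{- Let $p\ge 5$ be a prime and $n$ a positive integer. Then $$pn\sum_{k=1}^{\lfloor p/3\rfloor}\binom{3k}{k,k,k}\frac{3^{ -3k}}{k}\equiv 3\left(3^{(p-1)n}-1\right)\pmod{p^2}.$$
   Context: $\binom{3k}{k,k,k}=\frac{(3k)!}{(k!)^3}$. For rational numbers $x,y$ whose denominators are prime to $p$, $x\equiv y \pmod{p^t}$ means $x-y\in p^t\mathbb{Z}_{(p)}$. -}

module Defs where

open import Data.Nat as ℕ using (ℕ; zero; suc; _!; NonZero)
open import Data.Nat.Properties using (_!≢0; m^n≢0; m*n≢0)
open import Data.Nat.Divisibility using (_∣_)
open import Data.Integer as ℤ using (ℤ; +_)
import Data.Integer.Divisibility as ℤDiv
open import Data.Rational as ℚ using (ℚ; _/_; _*_; _-_; _+_; 0ℚ)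
open import Data.List using (List; foldr; map; upTo)
open import Data.Product using (Σ; _×_)
open import Relation.Nullary using (¬_)
open import Relation.Binary.PropositionalEquality using (_≡_)

-- multinomial coefficient (3k choose k,k,k) = (3k)! / (k!)^3  (exact division in ℕ)
multinomial3 : ℕ → ℕ
multinomial3 k = (3 ℕ.* k) ! ℕ./ ((k ! ℕ.* k !) ℕ.* k !)
  where instance
    nz : NonZero ((k ! ℕ.* k !) ℕ.* k !)
    nz = m*n≢0 (k ! ℕ.* k !) (k !) {{m*n≢0 (k !) (k !) {{k !≢0}} {{k !≢0}}}} {{k !≢0}}

sumℚ : List ℚ → ℚ
sumℚ = foldr _+_ 0ℚ

sumFrom1 : ℕ → (ℕ → ℚ) → ℚ
sumFrom1 m f = sumℚ (map (λ i → f (suc i)) (upTo m))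

-- the summand  binom(3k;k,k,k) * 3^{-3k} / k,  for k ≥ 1, written as  binom / (k * 27^k)
term : ℕ → ℚ
term zero    = 0ℚ
term (suc j) = (+ multinomial3 (suc j)) / (suc j ℕ.* 27 ℕ.^ suc j)
  where instance
    nz : NonZero (suc j ℕ.* 27 ℕ.^ suc j)
    nz = m*n≢0 (suc j) (27 ℕ.^ suc j) {{ℕ.nonZero}} {{m^n≢0 27 (suc j)}}

-- x ≡ y (mod p^t) in ℤ_(p):  x - y ∈ p^t ℤ_(p), i.e. (x - y) = a / b with p ∤ b and p^t ∣ a
_≡_[mod_^_] : ℚ → ℚ → ℕ → ℕ → Set
x ≡ y [mod p ^ t ] =
  Σ ℤ λ a → Σ ℕ λ b → Σ (NonZero b) λ nzb →
    (¬ (p ∣ b)) × ((+ (p ℕ.^ t)) ℤDiv.∣ a) × (x - y ≡ (_/_ a b {{nzb}}))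

module Submission where

-- Write S for the sum, H_m = Σ_{j≤m} 1/j and q = p - 1.
-- (1) Over ℚ: binom(3k;k,k,k)/27^k = Π_{t<k} (3t+1)(3t+2)/(9(t+1)²), and the binomial-harmonic
--     identity Σ_{k=1}^{n} (-1)^k binom(n,k) binom(n+k,k)/k = -2 H_n holds (telescoping in n).
-- (2) Since p ∣ (3m+1)(3m+2), each ratio (3t+1)(3t+2)/(9(t+1)²) is ≡ -(m-t)(m+1+t)/(t+1)² mod p,
--     the ratio of (-1)^k binom(m,k) binom(m+k,k); so by (1)  S ≡ -2 H_m  (mod p).
-- (3) Factoring (p-1)! once by residues mod 3 and once directly, and expanding
--     Π (1 + p zᵢ) ≡ 1 + p Σ zᵢ (mod p²) with H_{q-m} ≡ H_m (mod p):  3^q ≡ 1 - (2/3) p H_m (mod p²).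
-- (4) Hence p S ≡ 3 (3^q - 1) (mod p²); as 3^q ≡ 1 (mod p), the geometric sum gives
--     3 (3^{qn} - 1) = 3 (3^q - 1) Σ_{i<n} 3^{qi} ≡ n · 3 (3^q - 1)  (mod p²).
-- Congruences are expressed through the predicate "x ∈ p^t ℤ₍ₚ₎" on ℚ (closed under sums and
-- products); the last step converts it into the relation of the statement.

open import Defs
open import Data.Nat using (ℕ; _≥_; _∸_; _^_)
import Data.Nat as ℕ
open import Data.Nat.Primality using (Prime)
open import Data.Integer using (+_)
open import Data.Rational using (ℚ; _*_; _-_; 1ℚ; _/_)

open import Data.Nat using (zero; suc; NonZero; _!; z≤n; s≤s)
import Data.Nat.Properties as ℕP
import Data.Nat.Divisibility as ℕD
import Data.Nat.DivMod as ℕDM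
open import Data.Nat.Combinatorics using (k![n∸k]!∣n!)
open import Data.Nat.Primality using (euclidsLemma; prime⇒irreducible)
open import Data.Integer as ℤ using (ℤ)
import Data.Integer.Properties as ℤP
import Data.Integer.Divisibility.Signed as ℤDS
open import Data.Rational using (_+_; -_; 0ℚ; fromℚᵘ)
import Data.Rational.Properties as ℚP
import Data.Rational.Unnormalised as ℚᵘ
import Data.Rational.Unnormalised.Properties as ℚᵘP
import Data.Rational.Solver as ℚSolver
import Data.Nat.Solver as ℕSolver
import Data.Integer.Solver as ℤSolver
open import Data.List using (map; applyUpTo)
open import Data.Product using (Σ; _,_; proj₁; proj₂)
open import Data.Sum using (_⊎_; inj₁; inj₂)
open import Data.Empty using (⊥-elim)
open import Function using (_∘_)
open import Relation.Nullary using (¬_)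
open import Relation.Binary.PropositionalEquality
open import Relation.Binary.Bundles using (Setoid)
import Relation.Binary.Reasoning.Setoid as SetoidReasoning
open import Level using (0ℓ)

*-nonZero : ∀ m n → .{{NonZero m}} → .{{NonZero n}} → NonZero (m ℕ.* n)
*-nonZero m n = ℕP.m*n≢0 m n

fromℚᵘ-+ : ∀ x y → fromℚᵘ (x ℚᵘ.+ y) ≡ fromℚᵘ x + fromℚᵘ y
fromℚᵘ-+ x y = ℚP.toℚᵘ-injective (ℚᵘP.≃-trans (ℚP.toℚᵘ-fromℚᵘ (x ℚᵘ.+ y)) (ℚᵘP.≃-sym
  (ℚᵘP.≃-trans (ℚP.toℚᵘ-homo-+ (fromℚᵘ x) (fromℚᵘ y))
               (ℚᵘP.+-cong (ℚP.toℚᵘ-fromℚᵘ x) (ℚP.toℚᵘ-fromℚᵘ y)))))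

fromℚᵘ-* : ∀ x y → fromℚᵘ (x ℚᵘ.* y) ≡ fromℚᵘ x * fromℚᵘ y
fromℚᵘ-* x y = ℚP.toℚᵘ-injective (ℚᵘP.≃-trans (ℚP.toℚᵘ-fromℚᵘ (x ℚᵘ.* y)) (ℚᵘP.≃-sym
  (ℚᵘP.≃-trans (ℚP.toℚᵘ-homo-* (fromℚᵘ x) (fromℚᵘ y))
               (ℚᵘP.*-cong (ℚP.toℚᵘ-fromℚᵘ x) (ℚP.toℚᵘ-fromℚᵘ y)))))

/-+-/ : ∀ a b c d .{{_ : NonZero b}} .{{_ : NonZero d}} →
        (a / b) + (c / d) ≡ _/_ (a ℤ.* + d ℤ.+ c ℤ.* + b) (b ℕ.* d) {{*-nonZero b d}}
/-+-/ a (suc b) c (suc d) = sym (fromℚᵘ-+ (ℚᵘ.mkℚᵘ a b) (ℚᵘ.mkℚᵘ c d))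

/-*-/ : ∀ a b c d .{{_ : NonZero b}} .{{_ : NonZero d}} →
        (a / b) * (c / d) ≡ _/_ (a ℤ.* c) (b ℕ.* d) {{*-nonZero b d}}
/-*-/ a (suc b) c (suc d) = sym (fromℚᵘ-* (ℚᵘ.mkℚᵘ a b) (ℚᵘ.mkℚᵘ c d))

-‿/ : ∀ a b .{{_ : NonZero b}} → - (a / b) ≡ (ℤ.- a) / b
-‿/ a (suc b) = ℚP.toℚᵘ-injective (ℚᵘP.≃-trans (ℚP.toℚᵘ-homo‿- (a / suc b))
  (ℚᵘP.≃-trans (ℚᵘP.-‿cong (ℚP.toℚᵘ-fromℚᵘ (ℚᵘ.mkℚᵘ a b)))
               (ℚᵘP.≃-sym (ℚP.toℚᵘ-fromℚᵘ (ℚᵘ.mkℚᵘ (ℤ.- a) b)))))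

/-cross : ∀ a b c d .{{_ : NonZero b}} .{{_ : NonZero d}} → a ℤ.* + d ≡ c ℤ.* + b → a / b ≡ c / d
/-cross a (suc b) c (suc d) e = ℚP.fromℚᵘ-cong {ℚᵘ.mkℚᵘ a b} {ℚᵘ.mkℚᵘ c d} (ℚᵘ.*≡* e)

-- The embedding ι : ℕ → ℚ and the reciprocals recip k = 1/(k+1).  They are kept abstract so that
-- the type checker never unfolds the normalising gcd computations; only the listed laws are used.
abstract
  ι : ℕ → ℚ
  ι n = + n / 1

  recip : ℕ → ℚ
  recip k = + 1 / suc k

  ι-def : ∀ n → ι n ≡ + n / 1
  ι-def n = refl

  recip-def : ∀ k → recip k ≡ + 1 / suc k
  recip-def k = refl

  ι-+ : ∀ a b → ι (a ℕ.+ b) ≡ ι a + ι b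
  ι-+ a b = sym (trans (/-+-/ (+ a) 1 (+ b) 1) (cong (_/ 1)
    (trans (cong₂ ℤ._+_ (ℤP.*-identityʳ (+ a)) (ℤP.*-identityʳ (+ b))) (sym (ℤP.pos-+ a b)))))

  ι-* : ∀ a b → ι (a ℕ.* b) ≡ ι a * ι b
  ι-* a b = sym (trans (/-*-/ (+ a) 1 (+ b) 1) (cong (_/ 1) (sym (ℤP.pos-* a b))))

  ι0 : ι 0 ≡ 0ℚ
  ι0 = refl

  ι1 : ι 1 ≡ 1ℚ
  ι1 = refl

  recip-inverse : ∀ k → recip k * ι (suc k) ≡ 1ℚ
  recip-inverse k = trans (/-*-/ (+ 1) (suc k) (+ suc k) 1)
                          (/-cross (+ 1 ℤ.* + suc k) (suc k ℕ.* 1) (+ 1) 1 cross)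
    where
    cross : + 1 ℤ.* + suc k ℤ.* + 1 ≡ + 1 ℤ.* + (suc k ℕ.* 1)
    cross = trans (ℤP.*-identityʳ (+ 1 ℤ.* + suc k))
                  (cong (+ 1 ℤ.*_) (cong +_ (sym (ℕP.*-identityʳ (suc k)))))

ι-suc : ∀ a → ι (suc a) ≡ ι a + 1ℚ
ι-suc a = trans (cong ι (ℕP.+-comm 1 a)) (trans (ι-+ a 1) (cong (λ z → ι a + z) ι1))

/-split : ∀ a b c .{{_ : NonZero b}} .{{_ : NonZero c}} →
          _/_ (+ a) (b ℕ.* c) {{*-nonZero b c}} ≡ ι a * (+ 1 / b) * (+ 1 / c)
/-split a b c = sym (begin
    ι a * (+ 1 / b) * (+ 1 / c)
      ≡⟨ cong (λ x → x * (+ 1 / b) * (+ 1 / c)) (ι-def a) ⟩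
    (+ a / 1) * (+ 1 / b) * (+ 1 / c)
      ≡⟨ cong (_* (+ 1 / c)) (/-*-/ (+ a) 1 (+ 1) b) ⟩
    _/_ (+ a ℤ.* + 1) (1 ℕ.* b) {{*-nonZero 1 b}} * (+ 1 / c)
      ≡⟨ /-*-/ (+ a ℤ.* + 1) (1 ℕ.* b) (+ 1) c {{*-nonZero 1 b}} ⟩
    _/_ (+ a ℤ.* + 1 ℤ.* + 1) (1 ℕ.* b ℕ.* c) {{*-nonZero (1 ℕ.* b) c {{*-nonZero 1 b}}}}
      ≡⟨ /-cross (+ a ℤ.* + 1 ℤ.* + 1) (1 ℕ.* b ℕ.* c) (+ a) (b ℕ.* c)
                 {{*-nonZero (1 ℕ.* b) c {{*-nonZero 1 b}}}} {{*-nonZero b c}} cross ⟩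
    _/_ (+ a) (b ℕ.* c) {{*-nonZero b c}} ∎)
  where
  open ≡-Reasoning
  cross : + a ℤ.* + 1 ℤ.* + 1 ℤ.* + (b ℕ.* c) ≡ + a ℤ.* + (1 ℕ.* b ℕ.* c)
  cross = cong₂ (λ x y → x ℤ.* + (y ℕ.* c))
                (trans (ℤP.*-identityʳ (+ a ℤ.* + 1)) (ℤP.*-identityʳ (+ a))) (sym (ℕP.*-identityˡ b))

∑ : ℕ → (ℕ → ℚ) → ℚ
∑ zero    f = 0ℚ
∑ (suc n) f = f 0 + ∑ n (f ∘ suc)

∏ : ℕ → (ℕ → ℚ) → ℚ
∏ zero    f = 1ℚ
∏ (suc n) f = f 0 * ∏ n (f ∘ suc)

sumℚ-applyUpTo : ∀ n (g : ℕ → ℚ) (f : ℕ → ℕ) → sumℚ (map g (applyUpTo f n)) ≡ ∑ n (g ∘ f)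
sumℚ-applyUpTo zero    g f = refl
sumℚ-applyUpTo (suc n) g f = cong (λ s → g (f 0) + s) (sumℚ-applyUpTo n g (f ∘ suc))

sumFrom1-∑ : ∀ m (f : ℕ → ℚ) → sumFrom1 m f ≡ ∑ m (f ∘ suc)
sumFrom1-∑ m f = sumℚ-applyUpTo m (f ∘ suc) (λ i → i)

∑-last : ∀ n (f : ℕ → ℚ) → ∑ (suc n) f ≡ ∑ n f + f n
∑-last zero    f = trans (ℚP.+-identityʳ (f 0)) (sym (ℚP.+-identityˡ (f 0)))
∑-last (suc n) f = trans (cong (λ s → f 0 + s) (∑-last n (f ∘ suc))) (sym (ℚP.+-assoc (f 0) _ _))

∏-last : ∀ n (f : ℕ → ℚ) → ∏ (suc n) f ≡ ∏ n f * f n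
∏-last zero    f = trans (ℚP.*-identityʳ (f 0)) (sym (ℚP.*-identityˡ (f 0)))
∏-last (suc n) f = trans (cong (f 0 *_) (∏-last n (f ∘ suc))) (sym (ℚP.*-assoc (f 0) _ _))

∑-cong : ∀ n {f g : ℕ → ℚ} → (∀ i → i ℕ.< n → f i ≡ g i) → ∑ n f ≡ ∑ n g
∑-cong zero    h = refl
∑-cong (suc n) h = cong₂ _+_ (h 0 (s≤s z≤n)) (∑-cong n (λ i i<n → h (suc i) (s≤s i<n)))

∏-cong : ∀ n {f g : ℕ → ℚ} → (∀ i → i ℕ.< n → f i ≡ g i) → ∏ n f ≡ ∏ n g
∏-cong zero    h = refl
∏-cong (suc n) h = cong₂ _*_ (h 0 (s≤s z≤n)) (∏-cong n (λ i i<n → h (suc i) (s≤s i<n)))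

∑-+ : ∀ n (f g : ℕ → ℚ) → ∑ n (λ i → f i + g i) ≡ ∑ n f + ∑ n g
∑-+ zero    f g = refl
∑-+ (suc n) f g = trans (cong (λ s → (f 0 + g 0) + s) (∑-+ n (f ∘ suc) (g ∘ suc)))
                        (interchange (f 0) (g 0) _ _)
  where
  open ℚSolver.+-*-Solver
  interchange : ∀ a b c d → (a + b) + (c + d) ≡ (a + c) + (b + d)
  interchange = solve 4 (λ a b c d → (a :+ b) :+ (c :+ d) := (a :+ c) :+ (b :+ d)) refl

∑-scale : ∀ n c (f : ℕ → ℚ) → ∑ n (λ i → c * f i) ≡ c * ∑ n f
∑-scale zero    c f = sym (ℚP.*-zeroʳ c)
∑-scale (suc n) c f = trans (cong (λ s → c * f 0 + s) (∑-scale n c (f ∘ suc))) (sym (ℚP.*-distribˡ-+ c _ _))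

∑-neg : ∀ n (f : ℕ → ℚ) → ∑ n (λ i → - f i) ≡ - ∑ n f
∑-neg zero    f = refl
∑-neg (suc n) f = trans (cong (λ s → - f 0 + s) (∑-neg n (f ∘ suc))) (sym (ℚP.neg-distrib-+ (f 0) _))

∑-split : ∀ a b (f : ℕ → ℚ) → ∑ (a ℕ.+ b) f ≡ ∑ a f + ∑ b (λ i → f (a ℕ.+ i))
∑-split zero    b f = sym (ℚP.+-identityˡ (∑ b f))
∑-split (suc a) b f = trans (cong (λ s → f 0 + s) (∑-split a b (f ∘ suc))) (sym (ℚP.+-assoc (f 0) _ _))

∑-telescope : ∀ n (g : ℕ → ℚ) → ∑ n (λ i → g (suc i) - g i) ≡ g n - g 0
∑-telescope zero    g = sym (ℚP.+-inverseʳ (g 0))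
∑-telescope (suc n) g = trans (∑-last n (λ i → g (suc i) - g i))
  (trans (cong (_+ (g (suc n) - g n)) (∑-telescope n g)) (cancel (g n) (g 0) (g (suc n))))
  where
  open ℚSolver.+-*-Solver
  cancel : ∀ a b c → (a - b) + (c - a) ≡ c - b
  cancel = solve 3 (λ a b c → (a :- b) :+ (c :- a) := c :- b) refl

∑-const1 : ∀ n → ∑ n (λ _ → 1ℚ) ≡ ι n
∑-const1 zero    = sym ι0
∑-const1 (suc n) = trans (cong (λ s → 1ℚ + s) (∑-const1 n)) (trans (ℚP.+-comm 1ℚ (ι n)) (sym (ι-suc n)))

∏-* : ∀ n (f g : ℕ → ℚ) → ∏ n (λ i → f i * g i) ≡ ∏ n f * ∏ n g
∏-* zero    f g = refl
∏-* (suc n) f g = trans (cong ((f 0 * g 0) *_) (∏-* n (f ∘ suc) (g ∘ suc)))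
                        (interchange (f 0) (g 0) _ _)
  where
  open ℚSolver.+-*-Solver
  interchange : ∀ a b c d → (a * b) * (c * d) ≡ (a * c) * (b * d)
  interchange = solve 4 (λ a b c d → (a :* b) :* (c :* d) := (a :* c) :* (b :* d)) refl

∏-split : ∀ a b (f : ℕ → ℚ) → ∏ (a ℕ.+ b) f ≡ ∏ a f * ∏ b (λ i → f (a ℕ.+ i))
∏-split zero    b f = sym (ℚP.*-identityˡ (∏ b f))
∏-split (suc a) b f = trans (cong (f 0 *_) (∏-split a b (f ∘ suc))) (sym (ℚP.*-assoc (f 0) _ _))

∏-reverse : ∀ n (f : ℕ → ℚ) → ∏ n f ≡ ∏ n (λ i → f (n ∸ suc i))
∏-reverse zero    f = refl
∏-reverse (suc n) f = trans (∏-last n f) (trans (cong (_* f n) (∏-reverse n f)) (ℚP.*-comm _ (f n)))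

∏-reindex : ∀ n (f g : ℕ → ℚ) → (∀ a i → a ℕ.+ suc i ≡ n → f a ≡ g i) → ∏ n f ≡ ∏ n g
∏-reindex n f g h = trans (∏-reverse n f) (∏-cong n (λ i i<n → h (n ∸ suc i) i (ℕP.m∸n+n≡m i<n)))

∏-const1 : ∀ n → ∏ n (λ _ → 1ℚ) ≡ 1ℚ
∏-const1 zero    = refl
∏-const1 (suc n) = trans (ℚP.*-identityˡ _) (∏-const1 n)

∏-neg1-even : ∀ k → ∏ (k ℕ.+ k) (λ _ → - 1ℚ) ≡ 1ℚ
∏-neg1-even k = trans (∏-split k k (λ _ → - 1ℚ))
  (trans (sym (∏-* k (λ _ → - 1ℚ) (λ _ → - 1ℚ))) (∏-const1 k))

ι-factorial : ∀ n → ι (n !) ≡ ∏ n (λ i → ι (suc i))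
ι-factorial zero    = ι1
ι-factorial (suc n) = trans (ι-* (suc n) (n !)) (trans (cong (ι (suc n) *_) (ι-factorial n))
                        (trans (ℚP.*-comm (ι (suc n)) _) (sym (∏-last n (λ i → ι (suc i))))))

ι-factorial-+ : ∀ a b → ι ((a ℕ.+ b) !) ≡ ι (a !) * ∏ b (λ i → ι (suc (a ℕ.+ i)))
ι-factorial-+ a b = trans (ι-factorial (a ℕ.+ b)) (trans (∏-split a b (λ i → ι (suc i)))
                      (cong (_* ∏ b (λ i → ι (suc (a ℕ.+ i)))) (sym (ι-factorial a))))

∏-recip-inverse : ∀ n a → ∏ n (λ i → recip (a ℕ.+ i)) * ∏ n (λ i → ι (suc (a ℕ.+ i))) ≡ 1ℚ
∏-recip-inverse n a = trans (sym (∏-* n (λ i → recip (a ℕ.+ i)) (λ i → ι (suc (a ℕ.+ i)))))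
                        (trans (∏-cong n (λ i _ → recip-inverse (a ℕ.+ i))) (∏-const1 n))

ι-pow : ∀ a n → ι (a ^ n) ≡ ∏ n (λ _ → ι a)
ι-pow a zero    = ι1
ι-pow a (suc n) = trans (ι-* a (a ^ n)) (cong (ι a *_) (ι-pow a n))

geometric : ∀ a n → ι (a ^ n) - 1ℚ ≡ (ι a - 1ℚ) * ∑ n (λ i → ι (a ^ i))
geometric a zero    = trans (cong (_- 1ℚ) ι1) (trans (ℚP.+-inverseʳ 1ℚ) (sym (ℚP.*-zeroʳ (ι a - 1ℚ))))
geometric a (suc n) = begin
    ι (a ^ suc n) - 1ℚ                       ≡⟨ cong (_- 1ℚ) (ι-* a (a ^ n)) ⟩
    ι a * Y - 1ℚ                             ≡⟨ expand (ι a) Y ⟩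
    (Y - 1ℚ) + (ι a - 1ℚ) * Y                ≡⟨ cong (λ z → z + (ι a - 1ℚ) * Y) (geometric a n) ⟩
    (ι a - 1ℚ) * G + (ι a - 1ℚ) * Y          ≡⟨ sym (ℚP.*-distribˡ-+ (ι a - 1ℚ) G Y) ⟩
    (ι a - 1ℚ) * (G + Y)                     ≡⟨ cong ((ι a - 1ℚ) *_) (sym (∑-last n (λ i → ι (a ^ i)))) ⟩
    (ι a - 1ℚ) * ∑ (suc n) (λ i → ι (a ^ i)) ∎
  where
  open ≡-Reasoning
  open ℚSolver.+-*-Solver
  Y G : ℚ
  Y = ι (a ^ n)
  G = ∑ n (λ i → ι (a ^ i))
  expand : ∀ A Y → A * Y - 1ℚ ≡ (Y - 1ℚ) + (A - 1ℚ) * Y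
  expand = solve 2 (λ A Y → A :* Y :- con 1ℚ := (Y :- con 1ℚ) :+ (A :- con 1ℚ) :* Y) refl

-- 2 and 3 as closed rational terms, which the ring solver can use as constants.
three : ℚ
three = 1ℚ + 1ℚ + 1ℚ

two : ℚ
two = 1ℚ + 1ℚ

ι3 : ι 3 ≡ three
ι3 = trans (ι-suc 2) (cong (_+ 1ℚ) (trans (ι-suc 1) (cong (_+ 1ℚ) ι1)))

ι2 : ι 2 ≡ two
ι2 = trans (ι-suc 1) (cong (_+ 1ℚ) ι1)

ι-3* : ∀ k → ι (3 ℕ.* k) ≡ three * ι k
ι-3* k = trans (ι-* 3 k) (cong (_* ι k) ι3)

ι-3*+1 : ∀ k → ι (suc (3 ℕ.* k)) ≡ three * ι k + 1ℚ
ι-3*+1 k = trans (ι-suc (3 ℕ.* k)) (cong (_+ 1ℚ) (ι-3* k))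

ι-3*+2 : ∀ k → ι (suc (suc (3 ℕ.* k))) ≡ three * ι k + 1ℚ + 1ℚ
ι-3*+2 k = trans (ι-suc (suc (3 ℕ.* k))) (cong (_+ 1ℚ) (ι-3*+1 k))

⅓ : ℚ
⅓ = recip 2

⅓-inverse : ⅓ * three ≡ 1ℚ
⅓-inverse = trans (cong (⅓ *_) (sym ι3)) (recip-inverse 2)

-- (k!)³ divides (3k)!, so multinomial3 k is an exact quotient.
factorialCube : ℕ → ℕ
factorialCube k = (k ! ℕ.* k !) ℕ.* k !

factorialCube-nonZero : ∀ k → NonZero (factorialCube k)
factorialCube-nonZero k = ℕP.m*n≢0 (k ! ℕ.* k !) (k !) {{ℕP.m*n≢0 (k !) (k !) {{k ℕP.!≢0}} {{k ℕP.!≢0}}}} {{k ℕP.!≢0}}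

factorialCube-∣ : ∀ k → factorialCube k ℕD.∣ (3 ℕ.* k) !
factorialCube-∣ k = subst (ℕD._∣ (3 ℕ.* k) !) (ℕP.*-comm (k !) (k ! ℕ.* k !))
                          (ℕD.∣-trans (ℕD.*-monoʳ-∣ (k !) k!k!∣[2k]!) k![2k]!∣[3k]!)
  where
  k![2k]!∣[3k]! : k ! ℕ.* (2 ℕ.* k) ! ℕD.∣ (3 ℕ.* k) !
  k![2k]!∣[3k]! = subst (λ z → k ! ℕ.* z ! ℕD.∣ (3 ℕ.* k) !) (ℕP.m+n∸m≡n k (2 ℕ.* k))
                         (k![n∸k]!∣n! (ℕP.m≤m+n k (2 ℕ.* k)))
  k!k!∣[2k]! : k ! ℕ.* k ! ℕD.∣ (2 ℕ.* k) !
  k!k!∣[2k]! = subst (λ z → k ! ℕ.* z ! ℕD.∣ (2 ℕ.* k) !) (trans (ℕP.m+n∸m≡n k (1 ℕ.* k)) (ℕP.*-identityˡ k))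
                      (k![n∸k]!∣n! (ℕP.m≤m+n k (1 ℕ.* k)))

multinomial3-spec : ∀ k → factorialCube k ℕ.* multinomial3 k ≡ (3 ℕ.* k) !
multinomial3-spec k = ℕDM.m*[n/m]≡n {{factorialCube-nonZero k}} (factorialCube-∣ k)

risingTriple : ℕ → ℕ
risingTriple k = suc (3 ℕ.* k) ℕ.* suc (suc (3 ℕ.* k)) ℕ.* suc (suc (suc (3 ℕ.* k)))

multinomial3-step : ∀ k → multinomial3 (suc k) ℕ.* (suc k ℕ.* suc k ℕ.* suc k) ≡ multinomial3 k ℕ.* risingTriple k
multinomial3-step k = ℕP.*-cancelʳ-≡ _ _ (factorialCube k) {{factorialCube-nonZero k}} (begin
    M (suc k) ℕ.* (suc k ℕ.* suc k ℕ.* suc k) ℕ.* factorialCube k ≡⟨ regroup₁ (M (suc k)) (suc k) (k !) ⟩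
    factorialCube (suc k) ℕ.* M (suc k)                          ≡⟨ multinomial3-spec (suc k) ⟩
    (3 ℕ.* suc k) !                                               ≡⟨ cong _! (ℕP.*-suc 3 k) ⟩
    (suc (suc (suc (3 ℕ.* k)))) !                                 ≡⟨ regroup₂ (3 ℕ.* k) ((3 ℕ.* k) !) ⟩
    risingTriple k ℕ.* (3 ℕ.* k) !                                ≡⟨ cong (risingTriple k ℕ.*_) (sym (multinomial3-spec k)) ⟩
    risingTriple k ℕ.* (factorialCube k ℕ.* M k)                  ≡⟨ regroup₃ (risingTriple k) (factorialCube k) (M k) ⟩
    M k ℕ.* risingTriple k ℕ.* factorialCube k                    ∎)
  where
  open ≡-Reasoning
  open ℕSolver.+-*-Solver
  M : ℕ → ℕ
  M = multinomial3
  regroup₁ : ∀ a s f → a ℕ.* (s ℕ.* s ℕ.* s) ℕ.* ((f ℕ.* f) ℕ.* f) ≡ ((s ℕ.* f) ℕ.* (s ℕ.* f)) ℕ.* (s ℕ.* f) ℕ.* a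
  regroup₁ = solve 3 (λ a s f → a :* (s :* s :* s) :* ((f :* f) :* f) := ((s :* f) :* (s :* f)) :* (s :* f) :* a) refl
  regroup₂ : ∀ x f → suc (suc (suc x)) ℕ.* (suc (suc x) ℕ.* (suc x ℕ.* f)) ≡ suc x ℕ.* suc (suc x) ℕ.* suc (suc (suc x)) ℕ.* f
  regroup₂ = solve 2 (λ x f → (con 3 :+ x) :* ((con 2 :+ x) :* ((con 1 :+ x) :* f)) := (con 1 :+ x) :* (con 2 :+ x) :* (con 3 :+ x) :* f) refl
  regroup₃ : ∀ a b c → a ℕ.* (b ℕ.* c) ≡ c ℕ.* a ℕ.* b
  regroup₃ = solve 3 (λ a b c → a :* (b :* c) := c :* a :* b) refl

-- The ratio (3t+1)(3t+2) / (9 (t+1)²) of consecutive terms of binom(3k;k,k,k) / 27^k.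
tripleRatio : ℕ → ℚ
tripleRatio t = (three * ι t + 1ℚ) * (three * ι t + 1ℚ + 1ℚ) * ⅓ * ⅓ * recip t * recip t

risingTriple-ratio : ∀ k → ι (risingTriple k) * (recip k * recip k * recip k) ≡ ι 27 * tripleRatio k
risingTriple-ratio k = begin
    ι (risingTriple k) * (c * c * c)
      ≡⟨ cong (_* (c * c * c)) ι-risingTriple ⟩
    (three * x + 1ℚ) * (three * x + 1ℚ + 1ℚ) * (three * x + 1ℚ + 1ℚ + 1ℚ) * (c * c * c)
      ≡⟨ regroup₁ x c ⟩
    G * (c * (x + 1ℚ))
      ≡⟨ cong (G *_) (trans (cong (c *_) (sym (ι-suc k))) (recip-inverse k)) ⟩
    G * 1ℚ
      ≡⟨ cong (λ z → G * (z * z)) (sym ⅓-inverse) ⟩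
    G * ((⅓ * three) * (⅓ * three))
      ≡⟨ regroup₂ x c ⅓ ⟩
    (three * three * three) * tripleRatio k
      ≡⟨ cong (_* tripleRatio k) ι27 ⟩
    ι 27 * tripleRatio k ∎
  where
  open ≡-Reasoning
  open ℚSolver.+-*-Solver
  x c G : ℚ
  x = ι k
  c = recip k
  G = three * (three * x + 1ℚ) * (three * x + 1ℚ + 1ℚ) * c * c
  ι-risingTriple : ι (risingTriple k) ≡ (three * x + 1ℚ) * (three * x + 1ℚ + 1ℚ) * (three * x + 1ℚ + 1ℚ + 1ℚ)
  ι-risingTriple = trans (ι-* (suc (3 ℕ.* k) ℕ.* suc (suc (3 ℕ.* k))) (suc (suc (suc (3 ℕ.* k)))))
    (cong₂ _*_ (trans (ι-* (suc (3 ℕ.* k)) (suc (suc (3 ℕ.* k)))) (cong₂ _*_ (ι-3*+1 k) (ι-3*+2 k)))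
               (trans (ι-suc (suc (suc (3 ℕ.* k)))) (cong (_+ 1ℚ) (ι-3*+2 k))))
  ι27 : three * three * three ≡ ι 27
  ι27 = sym (trans (ι-* 9 3) (cong₂ _*_ (trans (ι-* 3 3) (cong₂ _*_ ι3 ι3)) ι3))
  regroup₁ : ∀ x c → (three * x + 1ℚ) * (three * x + 1ℚ + 1ℚ) * (three * x + 1ℚ + 1ℚ + 1ℚ) * (c * c * c)
                   ≡ three * (three * x + 1ℚ) * (three * x + 1ℚ + 1ℚ) * c * c * (c * (x + 1ℚ))
  regroup₁ = solve 2 (λ x c → (con three :* x :+ con 1ℚ) :* (con three :* x :+ con 1ℚ :+ con 1ℚ) :* (con three :* x :+ con 1ℚ :+ con 1ℚ :+ con 1ℚ) :* (c :* c :* c)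
                   := con three :* (con three :* x :+ con 1ℚ) :* (con three :* x :+ con 1ℚ :+ con 1ℚ) :* c :* c :* (c :* (x :+ con 1ℚ))) refl
  regroup₂ : ∀ x c y → three * (three * x + 1ℚ) * (three * x + 1ℚ + 1ℚ) * c * c * ((y * three) * (y * three))
                     ≡ (three * three * three) * ((three * x + 1ℚ) * (three * x + 1ℚ + 1ℚ) * y * y * c * c)
  regroup₂ = solve 3 (λ x c y → con three :* (con three :* x :+ con 1ℚ) :* (con three :* x :+ con 1ℚ :+ con 1ℚ) :* c :* c :* ((y :* con three) :* (y :* con three))
                     := (con three :* con three :* con three) :* ((con three :* x :+ con 1ℚ) :* (con three :* x :+ con 1ℚ :+ con 1ℚ) :* y :* y :* c :* c)) refl

ι-multinomial3 : ∀ k → ι (multinomial3 k) ≡ ι (27 ^ k) * ∏ k tripleRatio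
ι-multinomial3 zero    = trans ι1 (sym (trans (ℚP.*-identityʳ (ι 1)) ι1))
ι-multinomial3 (suc k) = begin
    ι (M (suc k))
      ≡⟨ sym (ℚP.*-identityʳ (ι (M (suc k)))) ⟩
    ι (M (suc k)) * 1ℚ
      ≡⟨ cong (λ z → ι (M (suc k)) * (z * z * z)) (sym (recip-inverse k)) ⟩
    ι (M (suc k)) * ((c * s) * (c * s) * (c * s))
      ≡⟨ regroup₁ (ι (M (suc k))) c s ⟩
    (ι (M (suc k)) * (s * s * s)) * (c * c * c)
      ≡⟨ cong (_* (c * c * c)) ι-step ⟩
    (ι (M k) * ι (risingTriple k)) * (c * c * c)
      ≡⟨ ℚP.*-assoc (ι (M k)) (ι (risingTriple k)) (c * c * c) ⟩
    ι (M k) * (ι (risingTriple k) * (c * c * c))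
      ≡⟨ cong₂ _*_ (ι-multinomial3 k) (risingTriple-ratio k) ⟩
    (ι (27 ^ k) * ∏ k tripleRatio) * (ι 27 * tripleRatio k)
      ≡⟨ regroup₂ (ι (27 ^ k)) (∏ k tripleRatio) (ι 27) (tripleRatio k) ⟩
    (ι 27 * ι (27 ^ k)) * (∏ k tripleRatio * tripleRatio k)
      ≡⟨ cong₂ _*_ (sym (ι-* 27 (27 ^ k))) (sym (∏-last k tripleRatio)) ⟩
    ι (27 ^ suc k) * ∏ (suc k) tripleRatio ∎
  where
  open ≡-Reasoning
  open ℚSolver.+-*-Solver
  M : ℕ → ℕ
  M = multinomial3
  c s : ℚ
  c = recip k
  s = ι (suc k)
  ι-step : ι (M (suc k)) * (s * s * s) ≡ ι (M k) * ι (risingTriple k)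
  ι-step = trans (cong (ι (M (suc k)) *_) (sym (trans (ι-* (suc k ℕ.* suc k) (suc k)) (cong (_* s) (ι-* (suc k) (suc k))))))
             (trans (sym (ι-* (M (suc k)) (suc k ℕ.* suc k ℕ.* suc k)))
             (trans (cong ι (multinomial3-step k)) (ι-* (M k) (risingTriple k))))
  regroup₁ : ∀ a c s → a * ((c * s) * (c * s) * (c * s)) ≡ (a * (s * s * s)) * (c * c * c)
  regroup₁ = solve 3 (λ a c s → a :* ((c :* s) :* (c :* s) :* (c :* s)) := (a :* (s :* s :* s)) :* (c :* c :* c)) refl
  regroup₂ : ∀ a b c d → (a * b) * (c * d) ≡ (c * a) * (b * d)
  regroup₂ = solve 4 (λ a b c d → (a :* b) :* (c :* d) := (c :* a) :* (b :* d)) refl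

term-as-product : ∀ j → term (suc j) ≡ recip j * ∏ (suc j) tripleRatio
term-as-product j = begin
    term (suc j)
      ≡⟨ /-split (multinomial3 (suc j)) (suc j) (27 ^ suc j) {{_}} {{nz}} ⟩
    ι (multinomial3 (suc j)) * (+ 1 / suc j) * E
      ≡⟨ cong₂ (λ a b → a * b * E) (ι-multinomial3 (suc j)) (sym (recip-def j)) ⟩
    ι (27 ^ suc j) * R * recip j * E
      ≡⟨ regroup (ι (27 ^ suc j)) R (recip j) E ⟩
    recip j * R * (E * ι (27 ^ suc j))
      ≡⟨ cong (λ z → recip j * R * z) E-inverse ⟩
    recip j * R * 1ℚ
      ≡⟨ ℚP.*-identityʳ (recip j * R) ⟩
    recip j * R ∎
  where
  open ≡-Reasoning
  open ℚSolver.+-*-Solver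
  nz : NonZero (27 ^ suc j)
  nz = ℕP.m^n≢0 27 (suc j)
  R E : ℚ
  R = ∏ (suc j) tripleRatio
  E = _/_ (+ 1) (27 ^ suc j) {{nz}}
  E-inverse : E * ι (27 ^ suc j) ≡ 1ℚ
  E-inverse with 27 ^ suc j | nz
  ... | suc b | _ = trans (cong (λ z → z * ι (suc b)) (sym (recip-def b))) (recip-inverse b)
  regroup : ∀ a b c e → a * b * c * e ≡ c * b * (e * a)
  regroup = solve 4 (λ a b c e → a :* b :* c :* e := c :* b :* (e :* a)) refl

ι-factorial-3k : ∀ k → ι ((3 ℕ.* k) !) ≡ ι (3 ^ k) * ι (k !) * ∏ k (λ s → ι (suc (3 ℕ.* s))) * ∏ k (λ s → ι (suc (suc (3 ℕ.* s))))
ι-factorial-3k zero    = sym (trans (ℚP.*-identityʳ _) (trans (ℚP.*-identityʳ _) (trans (cong₂ _*_ ι1 ι1) (trans (ℚP.*-identityˡ 1ℚ) (sym ι1)))))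
ι-factorial-3k (suc k) = begin
    ι ((3 ℕ.* suc k) !)
      ≡⟨ cong (λ z → ι (z !)) (ℕP.*-suc 3 k) ⟩
    ι (suc (suc (suc K)) ℕ.* (suc (suc K) ℕ.* (suc K ℕ.* K !)))
      ≡⟨ trans (ι-* (suc (suc (suc K))) _) (cong (ι (suc (suc (suc K))) *_) (trans (ι-* (suc (suc K)) _) (cong (ι (suc (suc K)) *_) (ι-* (suc K) (K !))))) ⟩
    ι (suc (suc (suc K))) * (ι (suc (suc K)) * (ι (suc K) * ι (K !)))
      ≡⟨ cong₂ (λ a z → a * (ι (suc (suc K)) * (ι (suc K) * z))) ι-3k+3 (ι-factorial-3k k) ⟩
    three * ι (suc k) * (ι (suc (suc K)) * (ι (suc K) * (ι (3 ^ k) * ι (k !) * A * B)))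
      ≡⟨ regroup three (ι (suc k)) (ι (suc (suc K))) (ι (suc K)) (ι (3 ^ k)) (ι (k !)) A B ⟩
    (three * ι (3 ^ k)) * (ι (suc k) * ι (k !)) * (A * ι (suc K)) * (B * ι (suc (suc K)))
      ≡⟨ cong₂ (λ a b → a * b * (A * ι (suc K)) * (B * ι (suc (suc K))))
               (sym (trans (ι-* 3 (3 ^ k)) (cong (_* ι (3 ^ k)) ι3))) (sym (ι-* (suc k) (k !))) ⟩
    ι (3 ^ suc k) * ι (suc k !) * (A * ι (suc K)) * (B * ι (suc (suc K)))
      ≡⟨ cong₂ (λ a b → ι (3 ^ suc k) * ι (suc k !) * a * b)
               (sym (∏-last k (λ s → ι (suc (3 ℕ.* s))))) (sym (∏-last k (λ s → ι (suc (suc (3 ℕ.* s)))))) ⟩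
    ι (3 ^ suc k) * ι (suc k !) * ∏ (suc k) (λ s → ι (suc (3 ℕ.* s))) * ∏ (suc k) (λ s → ι (suc (suc (3 ℕ.* s)))) ∎
  where
  open ≡-Reasoning
  open ℚSolver.+-*-Solver
  K : ℕ
  K = 3 ℕ.* k
  A B : ℚ
  A = ∏ k (λ s → ι (suc (3 ℕ.* s)))
  B = ∏ k (λ s → ι (suc (suc (3 ℕ.* s))))
  ι-3k+3 : ι (suc (suc (suc K))) ≡ three * ι (suc k)
  ι-3k+3 = trans (cong ι (sym (ℕP.*-suc 3 k))) (ι-3* (suc k))
  regroup : ∀ t x b a u f A B → t * x * (b * (a * (u * f * A * B))) ≡ (t * u) * (x * f) * (A * a) * (B * b)
  regroup = solve 8 (λ t x b a u f A B → t :* x :* (b :* (a :* (u :* f :* A :* B))) := (t :* u) :* (x :* f) :* (A :* a) :* (B :* b)) refl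
-- The binomial-harmonic identity  Σ_{k=1}^{n} (-1)^k binom(n,k) binom(n+k,k) / k = -2 H_n.
-- The terms are written as products of their consecutive ratios, so that no binomial
-- coefficients are needed: altTerm n k = (-1)^k binom(n,k) binom(n+k,k) and
-- altTerm⁺ n k = (-1)^k binom(n,k) binom(n+1+k,k).

altRatio : ℕ → ℕ → ℚ
altRatio n t = - ((ι n - ι t) * (ι n + 1ℚ + ι t)) * recip t * recip t

altRatio⁺ : ℕ → ℕ → ℚ
altRatio⁺ n t = - ((ι n - ι t) * (ι n + 1ℚ + 1ℚ + ι t)) * recip t * recip t

altTerm : ℕ → ℕ → ℚ
altTerm n k = ∏ k (altRatio n)

altTerm⁺ : ℕ → ℕ → ℚ
altTerm⁺ n k = ∏ k (altRatio⁺ n)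

H : ℕ → ℚ
H n = ∑ n recip

altTerm-shift : ∀ n j → altTerm n j * (ι n + 1ℚ + ι j) ≡ altTerm⁺ n j * (ι n + 1ℚ)
altTerm-shift n zero = cong (1ℚ *_) (trans (cong (λ z → ι n + 1ℚ + z) ι0) (ℚP.+-identityʳ (ι n + 1ℚ)))
altTerm-shift n (suc j) = begin
    altTerm n (suc j) * (ι n + 1ℚ + ι (suc j))
      ≡⟨ cong₂ (λ a b → a * (ι n + 1ℚ + b)) (∏-last j (altRatio n)) (ι-suc j) ⟩
    altTerm n j * altRatio n j * (ι n + 1ℚ + (ι j + 1ℚ))
      ≡⟨ ratio-shift (altTerm n j) (ι n) (ι j) (recip j) ⟩
    (altTerm n j * (ι n + 1ℚ + ι j)) * altRatio⁺ n j
      ≡⟨ cong (_* altRatio⁺ n j) (altTerm-shift n j) ⟩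
    altTerm⁺ n j * (ι n + 1ℚ) * altRatio⁺ n j
      ≡⟨ swap (altTerm⁺ n j) (ι n + 1ℚ) (altRatio⁺ n j) ⟩
    (altTerm⁺ n j * altRatio⁺ n j) * (ι n + 1ℚ)
      ≡⟨ cong (_* (ι n + 1ℚ)) (sym (∏-last j (altRatio⁺ n))) ⟩
    altTerm⁺ n (suc j) * (ι n + 1ℚ) ∎
  where
  open ≡-Reasoning
  open ℚSolver.+-*-Solver
  ratio-shift : ∀ W x y c → W * (- ((x - y) * (x + 1ℚ + y)) * c * c) * (x + 1ℚ + (y + 1ℚ))
                ≡ (W * (x + 1ℚ + y)) * (- ((x - y) * (x + 1ℚ + 1ℚ + y)) * c * c)
  ratio-shift = solve 4 (λ W x y c → W :* (:- ((x :- y) :* (x :+ con 1ℚ :+ y)) :* c :* c) :* (x :+ con 1ℚ :+ (y :+ con 1ℚ))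
                := (W :* (x :+ con 1ℚ :+ y)) :* (:- ((x :- y) :* (x :+ con 1ℚ :+ con 1ℚ :+ y)) :* c :* c)) refl
  swap : ∀ a b c → a * b * c ≡ (a * c) * b
  swap = solve 3 (λ a b c → a :* b :* c := (a :* c) :* b) refl

altRatio-suc : ∀ n j → altRatio (suc n) j ≡ (ι n + 1ℚ - ι j) * (- (ι n + 1ℚ + 1ℚ + ι j) * recip j * recip j)
altRatio-suc n j = trans (cong (λ z → - ((z - ι j) * (z + 1ℚ + ι j)) * recip j * recip j) (ι-suc n)) (factor (ι n) (ι j) (recip j))
  where
  open ℚSolver.+-*-Solver
  factor : ∀ x y c → - ((x + 1ℚ - y) * (x + 1ℚ + 1ℚ + y)) * c * c ≡ (x + 1ℚ - y) * (- (x + 1ℚ + 1ℚ + y) * c * c)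
  factor = solve 3 (λ x y c → :- ((x :+ con 1ℚ :- y) :* (x :+ con 1ℚ :+ con 1ℚ :+ y)) :* c :* c := (x :+ con 1ℚ :- y) :* (:- (x :+ con 1ℚ :+ con 1ℚ :+ y) :* c :* c)) refl

altTerm-suc : ∀ n j → altTerm (suc n) j * (ι n + 1ℚ - ι j) ≡ altTerm⁺ n j * (ι n + 1ℚ)
altTerm-suc n zero = cong (1ℚ *_) (trans (cong (λ z → ι n + 1ℚ - z) ι0) (ℚP.+-identityʳ (ι n + 1ℚ)))
altTerm-suc n (suc j) = begin
    altTerm (suc n) (suc j) * (ι n + 1ℚ - ι (suc j))
      ≡⟨ cong₂ (λ a b → a * (ι n + 1ℚ - b)) (∏-last j (altRatio (suc n))) (ι-suc j) ⟩
    altTerm (suc n) j * altRatio (suc n) j * (ι n + 1ℚ - (ι j + 1ℚ))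
      ≡⟨ cong (λ z → altTerm (suc n) j * z * (ι n + 1ℚ - (ι j + 1ℚ))) (altRatio-suc n j) ⟩
    altTerm (suc n) j * ((ι n + 1ℚ - ι j) * (- (ι n + 1ℚ + 1ℚ + ι j) * recip j * recip j)) * (ι n + 1ℚ - (ι j + 1ℚ))
      ≡⟨ ratio-suc (altTerm (suc n) j) (ι n) (ι j) (recip j) ⟩
    (altTerm (suc n) j * (ι n + 1ℚ - ι j)) * altRatio⁺ n j
      ≡⟨ cong (_* altRatio⁺ n j) (altTerm-suc n j) ⟩
    altTerm⁺ n j * (ι n + 1ℚ) * altRatio⁺ n j
      ≡⟨ swap (altTerm⁺ n j) (ι n + 1ℚ) (altRatio⁺ n j) ⟩
    (altTerm⁺ n j * altRatio⁺ n j) * (ι n + 1ℚ)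
      ≡⟨ cong (_* (ι n + 1ℚ)) (sym (∏-last j (altRatio⁺ n))) ⟩
    altTerm⁺ n (suc j) * (ι n + 1ℚ) ∎
  where
  open ≡-Reasoning
  open ℚSolver.+-*-Solver
  ratio-suc : ∀ W x y c → W * ((x + 1ℚ - y) * (- (x + 1ℚ + 1ℚ + y) * c * c)) * (x + 1ℚ - (y + 1ℚ))
                ≡ (W * (x + 1ℚ - y)) * (- ((x - y) * (x + 1ℚ + 1ℚ + y)) * c * c)
  ratio-suc = solve 4 (λ W x y c → W :* ((x :+ con 1ℚ :- y) :* (:- (x :+ con 1ℚ :+ con 1ℚ :+ y) :* c :* c)) :* (x :+ con 1ℚ :- (y :+ con 1ℚ))
                := (W :* (x :+ con 1ℚ :- y)) :* (:- ((x :- y) :* (x :+ con 1ℚ :+ con 1ℚ :+ y)) :* c :* c)) refl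
  swap : ∀ a b c → a * b * c ≡ (a * c) * b
  swap = solve 3 (λ a b c → a :* b :* c := (a :* c) :* b) refl

altRatio-split : ∀ n j → altRatio n j ≡ (ι n + 1ℚ + ι j) * (- (ι n - ι j) * recip j * recip j)
altRatio-split n j = factor (ι n) (ι j) (recip j)
  where
  open ℚSolver.+-*-Solver
  factor : ∀ x y c → - ((x - y) * (x + 1ℚ + y)) * c * c ≡ (x + 1ℚ + y) * (- (x - y) * c * c)
  factor = solve 3 (λ x y c → :- ((x :- y) :* (x :+ con 1ℚ :+ y)) :* c :* c := (x :+ con 1ℚ :+ y) :* (:- (x :- y) :* c :* c)) refl

-- The increment in n of the j-th summand telescopes in j:
-- (altTerm (n+1) (j+1) - altTerm n (j+1)) / (j+1) = (2/(n+1)) (altTerm⁺ n (j+1) - altTerm⁺ n j).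
altTerm-difference : ∀ n j → (altTerm (suc n) (suc j) - altTerm n (suc j)) * recip j ≡ two * recip n * (altTerm⁺ n (suc j) - altTerm⁺ n j)
altTerm-difference n j = begin
    (altTerm (suc n) (suc j) - altTerm n (suc j)) * c
      ≡⟨ cong₂ (λ a b → (a - b) * c) new-term old-term ⟩
    (V * (x + 1ℚ) * Z1 - V * (x + 1ℚ) * Z2) * c
      ≡⟨ expand-lhs V x y c ⟩
    G * (c * (y + 1ℚ))
      ≡⟨ cong (G *_) (trans (cong (c *_) (sym (ι-suc j))) (recip-inverse j)) ⟩
    G * 1ℚ
      ≡⟨ add-zero G (two * K * V) ⟩
    G * 1ℚ + two * K * V * (1ℚ * 1ℚ - 1ℚ)
      ≡⟨ cong₂ (λ a b → G * a + two * K * V * (b * b - 1ℚ)) (sym (trans (cong (K *_) (sym (ι-suc n))) (recip-inverse n))) (sym (trans (cong (c *_) (sym (ι-suc j))) (recip-inverse j))) ⟩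
    G * (K * (x + 1ℚ)) + two * K * V * ((c * (y + 1ℚ)) * (c * (y + 1ℚ)) - 1ℚ)
      ≡⟨ sym (expand-rhs V x y c K) ⟩
    two * K * (V * altRatio⁺ n j - V)
      ≡⟨ cong (λ z → two * K * (z - V)) (sym (∏-last j (altRatio⁺ n))) ⟩
    two * K * (altTerm⁺ n (suc j) - V) ∎
  where
  open ≡-Reasoning
  open ℚSolver.+-*-Solver
  x y c K V Z1 Z2 G : ℚ
  x = ι n
  y = ι j
  c = recip j
  K = recip n
  V = altTerm⁺ n j
  Z1 = - (x + 1ℚ + 1ℚ + y) * c * c
  Z2 = - (x - y) * c * c
  G = - (two * V * (x + 1ℚ) * c * c)
  new-term : altTerm (suc n) (suc j) ≡ V * (x + 1ℚ) * Z1
  new-term = trans (∏-last j (altRatio (suc n))) (trans (cong (altTerm (suc n) j *_) (altRatio-suc n j))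
         (trans (sym (ℚP.*-assoc (altTerm (suc n) j) (x + 1ℚ - y) Z1)) (cong (_* Z1) (altTerm-suc n j))))
  old-term : altTerm n (suc j) ≡ V * (x + 1ℚ) * Z2
  old-term = trans (∏-last j (altRatio n)) (trans (cong (altTerm n j *_) (altRatio-split n j))
         (trans (sym (ℚP.*-assoc (altTerm n j) (x + 1ℚ + y) Z2)) (cong (_* Z2) (altTerm-shift n j))))
  expand-lhs : ∀ V x y c → (V * (x + 1ℚ) * (- (x + 1ℚ + 1ℚ + y) * c * c) - V * (x + 1ℚ) * (- (x - y) * c * c)) * c
                    ≡ - ((1ℚ + 1ℚ) * V * (x + 1ℚ) * c * c) * (c * (y + 1ℚ))
  expand-lhs = solve 4 (λ V x y c → (V :* (x :+ con 1ℚ) :* (:- (x :+ con 1ℚ :+ con 1ℚ :+ y) :* c :* c) :- V :* (x :+ con 1ℚ) :* (:- (x :- y) :* c :* c)) :* c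
                    := :- ((con 1ℚ :+ con 1ℚ) :* V :* (x :+ con 1ℚ) :* c :* c) :* (c :* (y :+ con 1ℚ))) refl
  expand-rhs : ∀ V x y c K → (1ℚ + 1ℚ) * K * (V * (- ((x - y) * (x + 1ℚ + 1ℚ + y)) * c * c) - V)
        ≡ - ((1ℚ + 1ℚ) * V * (x + 1ℚ) * c * c) * (K * (x + 1ℚ)) + (1ℚ + 1ℚ) * K * V * ((c * (y + 1ℚ)) * (c * (y + 1ℚ)) - 1ℚ)
  expand-rhs = solve 5 (λ V x y c K → (con 1ℚ :+ con 1ℚ) :* K :* (V :* (:- ((x :- y) :* (x :+ con 1ℚ :+ con 1ℚ :+ y)) :* c :* c) :- V)
        := :- ((con 1ℚ :+ con 1ℚ) :* V :* (x :+ con 1ℚ) :* c :* c) :* (K :* (x :+ con 1ℚ)) :+ (con 1ℚ :+ con 1ℚ) :* K :* V :* ((c :* (y :+ con 1ℚ)) :* (c :* (y :+ con 1ℚ)) :- con 1ℚ)) refl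
  add-zero : ∀ G M → G * 1ℚ ≡ G * 1ℚ + M * (1ℚ * 1ℚ - 1ℚ)
  add-zero = solve 2 (λ G M → G :* con 1ℚ := G :* con 1ℚ :+ M :* (con 1ℚ :* con 1ℚ :- con 1ℚ)) refl

altTerm-vanishes : ∀ n → altTerm n (suc n) ≡ 0ℚ
altTerm-vanishes n = trans (∏-last n (altRatio n)) (trans (cong (altTerm n n *_) (last-factor (ι n) (recip n))) (ℚP.*-zeroʳ (altTerm n n)))
  where
  open ℚSolver.+-*-Solver
  last-factor : ∀ x c → - ((x - x) * (x + 1ℚ + x)) * c * c ≡ 0ℚ
  last-factor = solve 2 (λ x c → :- ((x :- x) :* (x :+ con 1ℚ :+ x)) :* c :* c := con 0ℚ) refl

altTerm⁺-vanishes : ∀ n → altTerm⁺ n (suc n) ≡ 0ℚ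
altTerm⁺-vanishes n = trans (∏-last n (altRatio⁺ n)) (trans (cong (altTerm⁺ n n *_) (last-factor (ι n) (recip n))) (ℚP.*-zeroʳ (altTerm⁺ n n)))
  where
  open ℚSolver.+-*-Solver
  last-factor : ∀ x c → - ((x - x) * (x + 1ℚ + 1ℚ + x)) * c * c ≡ 0ℚ
  last-factor = solve 2 (λ x c → :- ((x :- x) :* (x :+ con 1ℚ :+ con 1ℚ :+ x)) :* c :* c := con 0ℚ) refl

altTerm-harmonic : ∀ n → ∑ n (λ j → altTerm n (suc j) * recip j) ≡ - (two * H n)
altTerm-harmonic zero = refl
altTerm-harmonic (suc n) = begin
    ∑ (suc n) (λ j → altTerm (suc n) (suc j) * recip j)
      ≡⟨ ∑-cong (suc n) (λ j _ → split (altTerm (suc n) (suc j)) (altTerm n (suc j)) (recip j)) ⟩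
    ∑ (suc n) (λ j → altTerm n (suc j) * recip j + (altTerm (suc n) (suc j) - altTerm n (suc j)) * recip j)
      ≡⟨ ∑-+ (suc n) (λ j → altTerm n (suc j) * recip j) (λ j → (altTerm (suc n) (suc j) - altTerm n (suc j)) * recip j) ⟩
    ∑ (suc n) (λ j → altTerm n (suc j) * recip j) + ∑ (suc n) (λ j → (altTerm (suc n) (suc j) - altTerm n (suc j)) * recip j)
      ≡⟨ cong₂ _+_ old-sum increments ⟩
    (- (two * H n) + 0ℚ * recip n) + two * recip n * (0ℚ - 1ℚ)
      ≡⟨ collect (H n) (recip n) ⟩
    - (two * (H n + recip n))
      ≡⟨ cong (λ z → - (two * z)) (sym (∑-last n recip)) ⟩
    - (two * H (suc n)) ∎
  where
  open ≡-Reasoning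
  open ℚSolver.+-*-Solver
  split : ∀ a b c → a * c ≡ b * c + (a - b) * c
  split = solve 3 (λ a b c → a :* c := b :* c :+ (a :- b) :* c) refl
  collect : ∀ h k → (- ((1ℚ + 1ℚ) * h) + 0ℚ * k) + (1ℚ + 1ℚ) * k * (0ℚ - 1ℚ) ≡ - ((1ℚ + 1ℚ) * (h + k))
  collect = solve 2 (λ h k → (:- ((con 1ℚ :+ con 1ℚ) :* h) :+ con 0ℚ :* k) :+ (con 1ℚ :+ con 1ℚ) :* k :* (con 0ℚ :- con 1ℚ) := :- ((con 1ℚ :+ con 1ℚ) :* (h :+ k))) refl
  old-sum : ∑ (suc n) (λ j → altTerm n (suc j) * recip j) ≡ - (two * H n) + 0ℚ * recip n
  old-sum = trans (∑-last n (λ j → altTerm n (suc j) * recip j)) (cong₂ _+_ (altTerm-harmonic n) (cong (_* recip n) (altTerm-vanishes n)))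
  increments : ∑ (suc n) (λ j → (altTerm (suc n) (suc j) - altTerm n (suc j)) * recip j) ≡ two * recip n * (0ℚ - 1ℚ)
  increments = trans (∑-cong (suc n) (λ j _ → altTerm-difference n j))
       (trans (∑-scale (suc n) (two * recip n) (λ j → altTerm⁺ n (suc j) - altTerm⁺ n j))
       (cong (two * recip n *_) (trans (∑-telescope (suc n) (altTerm⁺ n)) (cong (_- 1ℚ) (altTerm⁺-vanishes n)))))

-- Q - T x = (-(T x)) (1 + Q (-(i c)))  when i T = 1 and c x = 1: each factor p - a of (p-1)! is
-- a unit times a number of the form 1 + p z.
factor-unit : ∀ Q T x i c → i * T ≡ 1ℚ → c * x ≡ 1ℚ → Q - T * x ≡ (- (T * x)) * (1ℚ + Q * (- (i * c)))
factor-unit Q T x i c iT≡1 cx≡1 = sym (trans (expand Q T x i c)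
  (trans (cong₂ (λ a b → - (T * x) + Q * a * b) iT≡1 cx≡1) (collapse Q T x)))
  where
  open ℚSolver.+-*-Solver
  expand : ∀ Q T x i c → (- (T * x)) * (1ℚ + Q * (- (i * c))) ≡ - (T * x) + Q * (i * T) * (c * x)
  expand = solve 5 (λ Q T x i c → (:- (T :* x)) :* (con 1ℚ :+ Q :* (:- (i :* c))) := :- (T :* x) :+ Q :* (i :* T) :* (c :* x)) refl
  collapse : ∀ Q T x → - (T * x) + Q * 1ℚ * 1ℚ ≡ Q - T * x
  collapse = solve 3 (λ Q T x → :- (T :* x) :+ Q :* con 1ℚ :* con 1ℚ := Q :- T :* x) refl

*-cancel-invertible : ∀ w w' a b → w' * w ≡ 1ℚ → w * a ≡ w * b → a ≡ b
*-cancel-invertible w w' a b w'w≡1 wa≡wb = begin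
    a                ≡⟨ sym (trans (cong (_* a) w'w≡1) (ℚP.*-identityˡ a)) ⟩
    (w' * w) * a     ≡⟨ ℚP.*-assoc w' w a ⟩
    w' * (w * a)     ≡⟨ cong (w' *_) wa≡wb ⟩
    w' * (w * b)     ≡⟨ sym (ℚP.*-assoc w' w b) ⟩
    (w' * w) * b     ≡⟨ trans (cong (_* b) w'w≡1) (ℚP.*-identityˡ b) ⟩
    b                ∎
  where open ≡-Reasoning

ι-complement : ∀ a b c → a ℕ.+ b ≡ c → ι a ≡ ι c - ι b
ι-complement a b c a+b≡c = trans (cancel (ι a) (ι b)) (cong (_- ι b) (trans (sym (ι-+ a b)) (cong ι a+b≡c)))
  where
  open ℚSolver.+-*-Solver
  cancel : ∀ x y → x ≡ x + y - y
  cancel = solve 2 (λ x y → x := x :+ y :- y) refl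

parity : ∀ d → Σ ℕ (λ k → d ≡ k ℕ.+ k) ⊎ Σ ℕ (λ k → d ≡ suc (k ℕ.+ k))
parity zero    = inj₁ (0 , refl)
parity (suc d) with parity d
... | inj₁ (k , d≡2k)   = inj₂ (k , cong suc d≡2k)
... | inj₂ (k , d≡2k+1) = inj₁ (suc k , trans (cong suc d≡2k+1) (cong suc (sym (ℕP.+-suc k k))))

ι-pow3 : ∀ n → ι (3 ^ n) ≡ ∏ n (λ _ → three)
ι-pow3 n = trans (ι-pow 3 n) (∏-cong n (λ _ _ → ι3))

module Modulo (p : ℕ) (p-prime : Prime p) (p≥5 : 5 ℕ.≤ p) where

  -- p^ t ∣ x  means  x ∈ p^t ℤ₍ₚ₎:  x = c p^t / b  for an integer c and a denominator b prime to p.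
  data p^_∣_ (t : ℕ) (x : ℚ) : Set where
    fraction : (c : ℤ) (b : ℕ) (b≢0 : NonZero b) → ¬ p ℕD.∣ b →
               x ≡ _/_ (c ℤ.* + (p ^ t)) b {{b≢0}} → p^ t ∣ x

  Integral : ℚ → Set
  Integral x = p^ 0 ∣ x

  ∤-* : ∀ {b d} → ¬ p ℕD.∣ b → ¬ p ℕD.∣ d → ¬ p ℕD.∣ (b ℕ.* d)
  ∤-* {b} {d} p∤b p∤d p∣bd with euclidsLemma b d p-prime p∣bd
  ... | inj₁ p∣b = p∤b p∣b
  ... | inj₂ p∣d = p∤d p∣d

  ∤-< : ∀ b .{{_ : NonZero b}} → b ℕ.< p → ¬ p ℕD.∣ b
  ∤-< b b<p = ℕD.>⇒∤ b<p

  ∤1 : ¬ p ℕD.∣ 1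
  ∤1 = ∤-< 1 (ℕP.≤-trans (s≤s (s≤s z≤n)) p≥5)

  ∣-+ : ∀ {t x y} → p^ t ∣ x → p^ t ∣ y → p^ t ∣ (x + y)
  ∣-+ {t} (fraction c b b≢0 p∤b refl) (fraction e d d≢0 p∤d refl) =
    fraction (c ℤ.* + d ℤ.+ e ℤ.* + b) (b ℕ.* d) bd≢0 (∤-* p∤b p∤d)
      (trans (/-+-/ (c ℤ.* + (p ^ t)) b (e ℤ.* + (p ^ t)) d {{b≢0}} {{d≢0}})
             (cong (λ w → _/_ w (b ℕ.* d) {{bd≢0}}) (factor c e (+ b) (+ d) (+ (p ^ t)))))
    where
    open ℤSolver.+-*-Solver
    bd≢0 : NonZero (b ℕ.* d)
    bd≢0 = *-nonZero b d {{b≢0}} {{d≢0}}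
    factor : ∀ c e b d P → c ℤ.* P ℤ.* d ℤ.+ e ℤ.* P ℤ.* b ≡ (c ℤ.* d ℤ.+ e ℤ.* b) ℤ.* P
    factor = solve 5 (λ c e b d P → c :* P :* d :+ e :* P :* b := (c :* d :+ e :* b) :* P) refl

  ∣-neg : ∀ {t x} → p^ t ∣ x → p^ t ∣ (- x)
  ∣-neg {t} (fraction c b b≢0 p∤b refl) = fraction (ℤ.- c) b b≢0 p∤b
    (trans (-‿/ (c ℤ.* + (p ^ t)) b {{b≢0}}) (cong (λ w → _/_ w b {{b≢0}}) (ℤP.neg-distribˡ-* c (+ (p ^ t)))))

  ∣-- : ∀ {t x y} → p^ t ∣ x → p^ t ∣ y → p^ t ∣ (x - y)
  ∣-- dx dy = ∣-+ dx (∣-neg dy)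

  ∣-* : ∀ {s t x y} → p^ s ∣ x → p^ t ∣ y → p^ (s ℕ.+ t) ∣ (x * y)
  ∣-* {s} {t} (fraction c b b≢0 p∤b refl) (fraction e d d≢0 p∤d refl) =
    fraction (c ℤ.* e) (b ℕ.* d) bd≢0 (∤-* p∤b p∤d)
      (trans (/-*-/ (c ℤ.* + (p ^ s)) b (e ℤ.* + (p ^ t)) d {{b≢0}} {{d≢0}})
             (cong (λ w → _/_ w (b ℕ.* d) {{bd≢0}}) (trans (regroup c e (+ (p ^ s)) (+ (p ^ t))) (cong (c ℤ.* e ℤ.*_) pˢpᵗ))))
    where
    open ℤSolver.+-*-Solver
    bd≢0 : NonZero (b ℕ.* d)
    bd≢0 = *-nonZero b d {{b≢0}} {{d≢0}}
    regroup : ∀ c e P Q → c ℤ.* P ℤ.* (e ℤ.* Q) ≡ c ℤ.* e ℤ.* (P ℤ.* Q)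
    regroup = solve 4 (λ c e P Q → c :* P :* (e :* Q) := c :* e :* (P :* Q)) refl
    pˢpᵗ : + (p ^ s) ℤ.* + (p ^ t) ≡ + (p ^ (s ℕ.+ t))
    pˢpᵗ = trans (sym (ℤP.pos-* (p ^ s) (p ^ t))) (cong +_ (sym (ℕP.^-distribˡ-+-* p s t)))

  ∣-weaken : ∀ {t x} → p^ suc t ∣ x → p^ t ∣ x
  ∣-weaken {t} (fraction c b b≢0 p∤b eq) = fraction (c ℤ.* + p) b b≢0 p∤b
    (trans eq (cong (λ w → _/_ w b {{b≢0}}) (trans (cong (c ℤ.*_) (ℤP.pos-* p (p ^ t))) (sym (ℤP.*-assoc c (+ p) (+ (p ^ t)))))))

  ∣-0 : ∀ t → p^ t ∣ 0ℚ
  ∣-0 t = fraction (+ 0) 1 _ ∤1 refl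

  integral-/ : ∀ z b .{{_ : NonZero b}} → ¬ p ℕD.∣ b → Integral (z / b)
  integral-/ z (suc b) p∤b = fraction z (suc b) _ p∤b (cong (λ w → w / suc b) (sym (ℤP.*-identityʳ z)))

  integral-ι : ∀ n → Integral (ι n)
  integral-ι n = subst Integral (sym (ι-def n)) (integral-/ (+ n) 1 ∤1)

  integral-recip : ∀ k → suc k ℕ.< p → Integral (recip k)
  integral-recip k k<p = subst Integral (sym (recip-def k)) (integral-/ (+ 1) (suc k) (∤-< (suc k) k<p))

  integral-1 : Integral 1ℚ
  integral-1 = subst Integral ι1 (integral-ι 1)

  integral-three : Integral three
  integral-three = ∣-+ (∣-+ integral-1 integral-1) integral-1

  integral-⅓ : Integral ⅓
  integral-⅓ = integral-recip 2 (ℕP.≤-trans (s≤s (s≤s (s≤s (s≤s z≤n)))) p≥5)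

  p^1∣p : p^ 1 ∣ ι p
  p^1∣p = fraction (+ 1) 1 _ ∤1 (trans (ι-def p)
    (cong (_/ 1) (trans (cong +_ (sym (ℕP.*-identityʳ p))) (sym (ℤP.*-identityˡ (+ (p ℕ.* 1)))))))

  p^1∣multiple : ∀ K → p ℕD.∣ K → p^ 1 ∣ ι K
  p^1∣multiple K (ℕD.divides q refl) = subst (p^ 1 ∣_) (trans (ℚP.*-comm (ι p) (ι q)) (sym (ι-* q p)))
                                             (∣-* p^1∣p (integral-ι q))

  infix 4 _≈_[p^_]
  data _≈_[p^_] (x y : ℚ) (t : ℕ) : Set where
    congruent : p^ t ∣ (x - y) → x ≈ y [p^ t ]

  difference : ∀ {t x y} → x ≈ y [p^ t ] → p^ t ∣ (x - y)
  difference (congruent d) = d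

  ≈-refl : ∀ {t} x → x ≈ x [p^ t ]
  ≈-refl {t} x = congruent (subst (p^ t ∣_) (sym (ℚP.+-inverseʳ x)) (∣-0 t))

  ≈-reflexive : ∀ {t x y} → x ≡ y → x ≈ y [p^ t ]
  ≈-reflexive {x = x} refl = ≈-refl x

  ≈-sym : ∀ {t x y} → x ≈ y [p^ t ] → y ≈ x [p^ t ]
  ≈-sym {t} {x} {y} (congruent d) = congruent (subst (p^ t ∣_) (negate x y) (∣-neg d))
    where
    open ℚSolver.+-*-Solver
    negate : ∀ x y → - (x - y) ≡ y - x
    negate = solve 2 (λ x y → :- (x :- y) := y :- x) refl

  ≈-trans : ∀ {t x y z} → x ≈ y [p^ t ] → y ≈ z [p^ t ] → x ≈ z [p^ t ]
  ≈-trans {t} {x} {y} {z} (congruent d) (congruent e) = congruent (subst (p^ t ∣_) (chain x y z) (∣-+ d e))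
    where
    open ℚSolver.+-*-Solver
    chain : ∀ x y z → (x - y) + (y - z) ≡ x - z
    chain = solve 3 (λ x y z → (x :- y) :+ (y :- z) := x :- z) refl

  ≈-setoid : ℕ → Setoid 0ℓ 0ℓ
  ≈-setoid t = record
    { Carrier = ℚ ; _≈_ = λ x y → x ≈ y [p^ t ]
    ; isEquivalence = record { refl = ≈-refl _ ; sym = ≈-sym ; trans = ≈-trans } }

  module ≈-Reasoning (t : ℕ) = SetoidReasoning (≈-setoid t)

  ≈-+ : ∀ {t x y u v} → x ≈ y [p^ t ] → u ≈ v [p^ t ] → x + u ≈ y + v [p^ t ]
  ≈-+ {t} {x} {y} {u} {v} (congruent d) (congruent e) = congruent (subst (p^ t ∣_) (interchange x y u v) (∣-+ d e))
    where
    open ℚSolver.+-*-Solver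
    interchange : ∀ x y u v → (x - y) + (u - v) ≡ (x + u) - (y + v)
    interchange = solve 4 (λ x y u v → (x :- y) :+ (u :- v) := (x :+ u) :- (y :+ v)) refl

  ≈-scale : ∀ {s t c x y} → p^ s ∣ c → x ≈ y [p^ t ] → c * x ≈ c * y [p^ s ℕ.+ t ]
  ≈-scale {s} {t} {c} {x} {y} dc (congruent d) = congruent (subst (p^ s ℕ.+ t ∣_) (distrib c x y) (∣-* dc d))
    where
    open ℚSolver.+-*-Solver
    distrib : ∀ c x y → c * (x - y) ≡ c * x - c * y
    distrib = solve 3 (λ c x y → c :* (x :- y) := c :* x :- c :* y) refl

  ≈-scaleˡ : ∀ {t c x y} → Integral c → x ≈ y [p^ t ] → c * x ≈ c * y [p^ t ]
  ≈-scaleˡ = ≈-scale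

  ≈-p* : ∀ {t x y} → x ≈ y [p^ t ] → ι p * x ≈ ι p * y [p^ suc t ]
  ≈-p* = ≈-scale p^1∣p

  ≈-* : ∀ {t x y u v} → Integral u → Integral y → x ≈ y [p^ t ] → u ≈ v [p^ t ] → x * u ≈ y * v [p^ t ]
  ≈-* {t} {x} {y} {u} {v} du dy (congruent d) (congruent e) =
    congruent (subst (p^ t ∣_) (expand x y u v) (∣-+ (∣-* du d) (∣-* dy e)))
    where
    open ℚSolver.+-*-Solver
    expand : ∀ x y u v → u * (x - y) + y * (u - v) ≡ x * u - y * v
    expand = solve 4 (λ x y u v → u :* (x :- y) :+ y :* (u :- v) := x :* u :- y :* v) refl

  ≈-weaken : ∀ {t x y} → x ≈ y [p^ suc t ] → x ≈ y [p^ t ]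
  ≈-weaken (congruent d) = congruent (∣-weaken d)

  ∣⇒≈0 : ∀ {t x} → p^ t ∣ x → x ≈ 0ℚ [p^ t ]
  ∣⇒≈0 {t} {x} d = congruent (subst (p^ t ∣_) (sym (ℚP.+-identityʳ x)) d)

  ∣-∑ : ∀ {t} n (f : ℕ → ℚ) → (∀ i → i ℕ.< n → p^ t ∣ f i) → p^ t ∣ ∑ n f
  ∣-∑ {t} zero    f h = ∣-0 t
  ∣-∑     (suc n) f h = ∣-+ (h 0 (s≤s z≤n)) (∣-∑ n (f ∘ suc) (λ i i<n → h (suc i) (s≤s i<n)))

  integral-∏ : ∀ n (f : ℕ → ℚ) → (∀ i → i ℕ.< n → Integral (f i)) → Integral (∏ n f)
  integral-∏ zero    f h = integral-1
  integral-∏ (suc n) f h = ∣-* (h 0 (s≤s z≤n)) (integral-∏ n (f ∘ suc) (λ i i<n → h (suc i) (s≤s i<n)))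

  ≈-∑ : ∀ {t} n (f g : ℕ → ℚ) → (∀ i → i ℕ.< n → f i ≈ g i [p^ t ]) → ∑ n f ≈ ∑ n g [p^ t ]
  ≈-∑ zero    f g h = ≈-refl 0ℚ
  ≈-∑ (suc n) f g h = ≈-+ (h 0 (s≤s z≤n)) (≈-∑ n (f ∘ suc) (g ∘ suc) (λ i i<n → h (suc i) (s≤s i<n)))

  ≈-∏ : ∀ {t} n (f g : ℕ → ℚ) → (∀ i → i ℕ.< n → Integral (f i)) → (∀ i → i ℕ.< n → Integral (g i)) →
        (∀ i → i ℕ.< n → f i ≈ g i [p^ t ]) → ∏ n f ≈ ∏ n g [p^ t ]
  ≈-∏ zero    f g hf hg h = ≈-refl 1ℚ
  ≈-∏ (suc n) f g hf hg h =
    ≈-* (integral-∏ n (f ∘ suc) (λ i i<n → hf (suc i) (s≤s i<n))) (hg 0 (s≤s z≤n)) (h 0 (s≤s z≤n))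
        (≈-∏ n (f ∘ suc) (g ∘ suc) (λ i i<n → hf (suc i) (s≤s i<n)) (λ i i<n → hg (suc i) (s≤s i<n))
             (λ i i<n → h (suc i) (s≤s i<n)))

  -- ∏ (1 + p zᵢ) ≡ 1 + p ∑ zᵢ  (mod p²)  for p-integral zᵢ: all cross terms contain p².
  ∏-linearise : ∀ n (z : ℕ → ℚ) → (∀ i → i ℕ.< n → Integral (z i)) →
                ∏ n (λ i → 1ℚ + ι p * z i) ≈ 1ℚ + ι p * ∑ n z [p^ 2 ]
  ∏-linearise zero    z h = ≈-reflexive (sym (trans (cong (λ x → 1ℚ + x) (ℚP.*-zeroʳ (ι p))) (ℚP.+-identityʳ 1ℚ)))
  ∏-linearise (suc n) z h = ≈-trans (≈-scaleˡ first-integral rest)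
    (congruent (subst (p^ 2 ∣_) cross-term (∣-* (∣-* p^1∣p p^1∣p) (∣-* (h 0 (s≤s z≤n)) sum-integral))))
    where
    open ℚSolver.+-*-Solver
    P Z : ℚ
    P = ι p
    Z = ∑ n (z ∘ suc)
    sum-integral : Integral Z
    sum-integral = ∣-∑ n (z ∘ suc) (λ i i<n → h (suc i) (s≤s i<n))
    first-integral : Integral (1ℚ + P * z 0)
    first-integral = ∣-+ integral-1 (∣-weaken (∣-* p^1∣p (h 0 (s≤s z≤n))))
    rest : ∏ n (λ i → 1ℚ + P * z (suc i)) ≈ 1ℚ + P * Z [p^ 2 ]
    rest = ∏-linearise n (z ∘ suc) (λ i i<n → h (suc i) (s≤s i<n))
    cross-term : P * P * (z 0 * Z) ≡ (1ℚ + P * z 0) * (1ℚ + P * Z) - (1ℚ + P * (z 0 + Z))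
    cross-term = solve 3 (λ P a b → P :* P :* (a :* b) := (con 1ℚ :+ P :* a) :* (con 1ℚ :+ P :* b) :- (con 1ℚ :+ P :* (a :+ b))) refl P (z 0) Z

  integral-tripleRatio : ∀ t → suc t ℕ.< p → Integral (tripleRatio t)
  integral-tripleRatio t t<p =
    ∣-* (∣-* (∣-* (∣-* (∣-* (∣-+ 3t integral-1) (∣-+ (∣-+ 3t integral-1) integral-1)) integral-⅓) integral-⅓)
             (integral-recip t t<p)) (integral-recip t t<p)
    where
    3t : Integral (three * ι t)
    3t = ∣-* integral-three (integral-ι t)

  integral-altRatio : ∀ n t → suc t ℕ.< p → Integral (altRatio n t)
  integral-altRatio n t t<p =
    ∣-* (∣-* (∣-neg (∣-* (∣-- (integral-ι n) (integral-ι t)) (∣-+ (∣-+ (integral-ι n) integral-1) (integral-ι t))))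
             (integral-recip t t<p)) (integral-recip t t<p)

  -- If p ∣ (3m+1)(3m+2) then (3t+1)(3t+2)/(9(t+1)²) ≡ -(m-t)(m+1+t)/(t+1)²  (mod p), because
  -- (3t+1)(3t+2) + 9 (m-t)(m+1+t) = (3m+1)(3m+2).
  tripleRatio≈altRatio : ∀ m → p ℕD.∣ suc (3 ℕ.* m) ℕ.* suc (suc (3 ℕ.* m)) →
                         ∀ t → suc t ℕ.< p → tripleRatio t ≈ altRatio m t [p^ 1 ]
  tripleRatio≈altRatio m p∣ t t<p = congruent (subst (p^ 1 ∣_) (sym difference-eq)
    (∣-* (∣-* (∣-* (∣-* (p^1∣multiple K p∣) integral-⅓) integral-⅓) (integral-recip t t<p)) (integral-recip t t<p)))
    where
    open ℚSolver.+-*-Solver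
    K : ℕ
    K = suc (3 ℕ.* m) ℕ.* suc (suc (3 ℕ.* m))
    x M c : ℚ
    x = ι t
    M = ι m
    c = recip t
    bracket : ℚ → ℚ
    bracket a = ((three * x + 1ℚ) * (three * x + 1ℚ + 1ℚ) * ⅓ * ⅓ + (M - x) * (M + 1ℚ + x) * a * a) * c * c
    common-denominator : ∀ x M i c →
      (three * x + 1ℚ) * (three * x + 1ℚ + 1ℚ) * i * i * c * c - (- ((M - x) * (M + 1ℚ + x)) * c * c)
      ≡ ((three * x + 1ℚ) * (three * x + 1ℚ + 1ℚ) * i * i + (M - x) * (M + 1ℚ + x) * 1ℚ * 1ℚ) * c * c
    common-denominator = solve 4 (λ x M i c →
      (con three :* x :+ con 1ℚ) :* (con three :* x :+ con 1ℚ :+ con 1ℚ) :* i :* i :* c :* c :- (:- ((M :- x) :* (M :+ con 1ℚ :+ x)) :* c :* c)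
      := ((con three :* x :+ con 1ℚ) :* (con three :* x :+ con 1ℚ :+ con 1ℚ) :* i :* i :+ (M :- x) :* (M :+ con 1ℚ :+ x) :* con 1ℚ :* con 1ℚ) :* c :* c) refl
    numerator : ∀ x M i c →
      ((three * x + 1ℚ) * (three * x + 1ℚ + 1ℚ) * i * i + (M - x) * (M + 1ℚ + x) * (i * three) * (i * three)) * c * c
      ≡ (three * M + 1ℚ) * (three * M + 1ℚ + 1ℚ) * i * i * c * c
    numerator = solve 4 (λ x M i c →
      ((con three :* x :+ con 1ℚ) :* (con three :* x :+ con 1ℚ :+ con 1ℚ) :* i :* i :+ (M :- x) :* (M :+ con 1ℚ :+ x) :* (i :* con three) :* (i :* con three)) :* c :* c
      := (con three :* M :+ con 1ℚ) :* (con three :* M :+ con 1ℚ :+ con 1ℚ) :* i :* i :* c :* c) refl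
    ι-K : ι K ≡ (three * M + 1ℚ) * (three * M + 1ℚ + 1ℚ)
    ι-K = trans (ι-* (suc (3 ℕ.* m)) (suc (suc (3 ℕ.* m)))) (cong₂ _*_ (ι-3*+1 m) (ι-3*+2 m))
    difference-eq : tripleRatio t - altRatio m t ≡ ι K * ⅓ * ⅓ * c * c
    difference-eq = trans (common-denominator x M ⅓ c) (trans (cong bracket (sym ⅓-inverse))
                      (trans (numerator x M ⅓ c) (cong (λ z → z * ⅓ * ⅓ * c * c) (sym ι-K))))

  S : ℕ → ℚ
  S m = ∑ m (λ j → term (suc j))

  S≈harmonic : ∀ m → m ℕ.< p → p ℕD.∣ suc (3 ℕ.* m) ℕ.* suc (suc (3 ℕ.* m)) → S m ≈ - (two * H m) [p^ 1 ]
  S≈harmonic m m<p p∣ = ≈-trans (≈-∑ m (λ j → term (suc j)) (λ j → altTerm m (suc j) * recip j) termwise)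
                                (≈-reflexive (altTerm-harmonic m))
    where
    termwise : ∀ j → j ℕ.< m → term (suc j) ≈ altTerm m (suc j) * recip j [p^ 1 ]
    termwise j j<m = ≈-trans (≈-reflexive (term-as-product j))
      (≈-trans (≈-scaleˡ (integral-recip j (ℕP.≤-trans (s≤s j<m) m<p))
                 (≈-∏ (suc j) tripleRatio (altRatio m) (λ t t≤j → integral-tripleRatio t (small t t≤j))
                      (λ t t≤j → integral-altRatio m t (small t t≤j)) (λ t t≤j → tripleRatio≈altRatio m p∣ t (small t t≤j))))
               (≈-reflexive (ℚP.*-comm (recip j) (altTerm m (suc j)))))
      where
      small : ∀ t → t ℕ.< suc j → suc t ℕ.< p
      small t t≤j = ℕP.≤-trans (s≤s (ℕP.≤-trans t≤j j<m)) m<p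

  q : ℕ
  q = p ∸ 1

  suc-q : suc q ≡ p
  suc-q = trans (ℕP.+-comm 1 q) (ℕP.m∸n+n≡m (ℕP.≤-trans (s≤s z≤n) p≥5))

  q<p : q ℕ.< p
  q<p = subst (q ℕ.<_) suc-q (ℕP.n<1+n q)

  -- 1/(a+1) + 1/(i+1) = p / ((a+1)(i+1)) ≡ 0  (mod p)  when (a+1) + (i+1) = p.
  recip-pair : ∀ a i → suc a ℕ.+ suc i ≡ p → - recip a ≈ recip i [p^ 1 ]
  recip-pair a i a+i≡p = congruent (subst (p^ 1 ∣_) (trans (cong -_ (sym pair-sum)) (ℚP.neg-distrib-+ A I))
    (∣-neg (∣-* (∣-* (integral-recip a a<p) (integral-recip i i<p)) p^1∣p)))
    where
    open ≡-Reasoning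
    open ℚSolver.+-*-Solver
    a<p : suc a ℕ.< p
    a<p = subst (suc a ℕ.<_) a+i≡p (ℕP.m<m+n (suc a) (s≤s z≤n))
    i<p : suc i ℕ.< p
    i<p = subst (suc i ℕ.<_) (trans (ℕP.+-comm (suc i) (suc a)) a+i≡p) (ℕP.m<m+n (suc i) (s≤s z≤n))
    A I : ℚ
    A = recip a
    I = recip i
    regroup : ∀ A I u v → A * (I * v) + I * (A * u) ≡ A * I * (u + v)
    regroup = solve 4 (λ A I u v → A :* (I :* v) :+ I :* (A :* u) := A :* I :* (u :+ v)) refl
    pair-sum : A + I ≡ A * I * ι p
    pair-sum = begin
      A + I                                      ≡⟨ cong₂ _+_ (sym (trans (cong (A *_) (recip-inverse i)) (ℚP.*-identityʳ A)))
                                                              (sym (trans (cong (I *_) (recip-inverse a)) (ℚP.*-identityʳ I))) ⟩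
      A * (I * ι (suc i)) + I * (A * ι (suc a))  ≡⟨ regroup A I (ι (suc a)) (ι (suc i)) ⟩
      A * I * (ι (suc a) + ι (suc i))            ≡⟨ cong (λ z → A * I * z) (sym (ι-+ (suc a) (suc i))) ⟩
      A * I * ι (suc a ℕ.+ suc i)                ≡⟨ cong (λ z → A * I * ι z) a+i≡p ⟩
      A * I * ι p                                ∎

  -- H_{q-i} ≡ H_q + H_i  (mod p), pairing 1/(q-i) with 1/(i+1).
  harmonic-reflect : ∀ i → i ℕ.≤ q → H (q ∸ i) ≈ H q + H i [p^ 1 ]
  harmonic-reflect zero    _    = ≈-reflexive (sym (ℚP.+-identityʳ (H q)))
  harmonic-reflect (suc i) i<q = begin
      H a                      ≡⟨ drop-last ⟩
      H (q ∸ i) - recip a      ≈⟨ ≈-+ (harmonic-reflect i (ℕP.≤-trans (ℕP.n≤1+n i) i<q)) (≈-refl (- recip a)) ⟩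
      (H q + H i) - recip a    ≈⟨ ≈-+ (≈-refl (H q + H i)) (recip-pair a i a+i≡p) ⟩
      (H q + H i) + recip i    ≡⟨ trans (ℚP.+-assoc (H q) (H i) (recip i)) (cong (λ z → H q + z) (sym (∑-last i recip))) ⟩
      H q + H (suc i)          ∎
    where
    open ≈-Reasoning 1
    open ℚSolver.+-*-Solver
    a : ℕ
    a = q ∸ suc i
    q-i≡1+a : q ∸ i ≡ suc a
    q-i≡1+a = ℕP.+-∸-assoc 1 i<q
    a+i≡p : suc a ℕ.+ suc i ≡ p
    a+i≡p = trans (cong suc (ℕP.m∸n+n≡m i<q)) suc-q
    cancel : ∀ x y → x ≡ (x + y) - y
    cancel = solve 2 (λ x y → x := (x :+ y) :- y) refl
    drop-last : H a ≡ H (q ∸ i) - recip a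
    drop-last = trans (cancel (H a) (recip a)) (cong (_- recip a) (sym (trans (cong H q-i≡1+a) (∑-last a recip))))

  -- H_{p-1} ≡ 0  (mod p): by reflection 0 = H_0 ≡ 2 H_{p-1}, and 2 is invertible modulo p.
  harmonic-full≈0 : H q ≈ 0ℚ [p^ 1 ]
  harmonic-full≈0 = begin
      H q                    ≡⟨ halve (H q) ⟩
      recip 1 * (H q + H q)  ≈⟨ ≈-scaleˡ (integral-recip 1 (ℕP.≤-trans (s≤s (s≤s (s≤s z≤n))) p≥5)) (≈-sym twice≈0) ⟩
      recip 1 * 0ℚ           ≡⟨ ℚP.*-zeroʳ (recip 1) ⟩
      0ℚ                     ∎
    where
    open ≈-Reasoning 1
    open ℚSolver.+-*-Solver
    twice≈0 : 0ℚ ≈ H q + H q [p^ 1 ]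
    twice≈0 = subst (λ z → H z ≈ H q + H q [p^ 1 ]) (ℕP.n∸n≡0 q) (harmonic-reflect q ℕP.≤-refl)
    double : ∀ i h → i * two * h ≡ i * (h + h)
    double = solve 2 (λ i h → i :* (con 1ℚ :+ con 1ℚ) :* h := i :* (h :+ h)) refl
    halve : ∀ h → h ≡ recip 1 * (h + h)
    halve h = sym (trans (sym (double (recip 1) h))
                  (trans (cong (λ z → recip 1 * z * h) (sym ι2)) (trans (cong (_* h) (recip-inverse 1)) (ℚP.*-identityˡ h))))

  harmonic-symmetric : ∀ m → m ℕ.≤ q → H (q ∸ m) ≈ H m [p^ 1 ]
  harmonic-symmetric m m≤q = ≈-trans (harmonic-reflect m m≤q)
    (≈-trans (≈-+ harmonic-full≈0 (≈-refl (H m))) (≈-reflexive (ℚP.+-identityˡ (H m))))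

  -- The Fermat quotient of 3.  Split q = p - 1 = m + (m + d) with d even, and assume the
  -- factorisation of (p-1)! obtained by sorting 1, …, p-1 by residue modulo 3:
  --   (p-1)! = 3^m m! ∏_{i<m} (p - 3(i+1)) ∏_{i<d} (2p - 3(m+1+i)).
  lowFactor : ℕ → ℚ
  lowFactor i = ι p - three * ι (suc i)

  highFactor : ℕ → ℕ → ℚ
  highFactor m i = two * ι p - three * ι (suc (m ℕ.+ i))

  module FermatQuotient (m d k : ℕ) (d-even : d ≡ k ℕ.+ k) (q-split : q ≡ m ℕ.+ (m ℕ.+ d))
                        (by-residues : ι (q !) ≡ ι (3 ^ m) * ι (m !) * ∏ m lowFactor * ∏ d (highFactor m)) where

    X : ℚ
    X = ι (3 ^ q)

    topFactor : ℕ → ℚ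
    topFactor i = ι p - ι (suc i)

    middle : ℚ
    middle = ∏ d (λ i → ι (suc (m ℕ.+ i)))

    by-size : ι (q !) ≡ ι (m !) * middle * ∏ m topFactor
    by-size = begin
        ι (q !)                                               ≡⟨ cong (λ z → ι (z !)) (sym q≡m'+m) ⟩
        ι ((m' ℕ.+ m) !)                                      ≡⟨ ι-factorial-+ m' m ⟩
        ι (m' !) * ∏ m (λ i → ι (suc (m' ℕ.+ i)))            ≡⟨ cong₂ _*_ (ι-factorial-+ m d) (∏-reindex m _ topFactor reflected) ⟩
        ι (m !) * middle * ∏ m topFactor                      ∎
      where
      open ≡-Reasoning
      m' : ℕ
      m' = m ℕ.+ d
      q≡m'+m : m' ℕ.+ m ≡ q
      q≡m'+m = sym (trans q-split (ℕP.+-comm m m'))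
      reflected : ∀ a i → a ℕ.+ suc i ≡ m → ι (suc (m' ℕ.+ a)) ≡ topFactor i
      reflected a i a+i≡m = ι-complement (suc (m' ℕ.+ a)) (suc i) p sum
        where
        sum : suc (m' ℕ.+ a) ℕ.+ suc i ≡ p
        sum = trans (cong suc (trans (ℕP.+-assoc m' a (suc i)) (trans (cong (m' ℕ.+_) a+i≡m) q≡m'+m))) suc-q

    -- Each factor is a unit times 1 + p z:
    --   p - 3(i+1) = -3(i+1) (1 - p/(3(i+1))),  2p - 3(m+1+i) = -3(m+1+i) (1 - 2p/(3(m+1+i))),
    --   p - (i+1) = -(i+1) (1 - p/(i+1)).
    zLow zHigh zTop : ℕ → ℚ
    zLow i  = - (⅓ * recip i)
    zHigh i = - (two * ⅓ * recip (m ℕ.+ i))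
    zTop i  = - recip i

    ∏Low ∏High ∏Top : ℚ
    ∏Low  = ∏ m (λ i → 1ℚ + ι p * zLow i)
    ∏High = ∏ d (λ i → 1ℚ + ι p * zHigh i)
    ∏Top  = ∏ m (λ i → 1ℚ + ι p * zTop i)

    signs threes : ℕ → ℚ
    signs n  = ∏ n (λ _ → - 1ℚ)
    threes n = ∏ n (λ _ → three)

    ∏lowFactor : ∏ m lowFactor ≡ signs m * threes m * ι (m !) * ∏Low
    ∏lowFactor = begin
        ∏ m lowFactor
          ≡⟨ ∏-cong m (λ i _ → factor-unit (ι p) three (ι (suc i)) ⅓ (recip i) ⅓-inverse (recip-inverse i)) ⟩
        ∏ m (λ i → - (three * ι (suc i)) * (1ℚ + ι p * zLow i))
          ≡⟨ ∏-* m (λ i → - (three * ι (suc i))) (λ i → 1ℚ + ι p * zLow i) ⟩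
        ∏ m (λ i → - (three * ι (suc i))) * ∏Low
          ≡⟨ cong (_* ∏Low) (trans (∏-cong m (λ i _ → sign-out (ι (suc i)))) (trans (∏-* m (λ _ → - 1ℚ * three) (λ i → ι (suc i)))
               (cong₂ _*_ (∏-* m (λ _ → - 1ℚ) (λ _ → three)) (sym (ι-factorial m))))) ⟩
        signs m * threes m * ι (m !) * ∏Low ∎
      where
      open ≡-Reasoning
      open ℚSolver.+-*-Solver
      sign-out : ∀ x → - (three * x) ≡ (- 1ℚ * three) * x
      sign-out = solve 1 (λ x → :- (con three :* x) := (:- con 1ℚ :* con three) :* x) refl

    ∏highFactor : ∏ d (highFactor m) ≡ threes d * middle * ∏High
    ∏highFactor = begin
        ∏ d (highFactor m)
          ≡⟨ ∏-cong d (λ i _ → trans (factor-unit (two * ι p) three (ι (suc (m ℕ.+ i))) ⅓ (recip (m ℕ.+ i)) ⅓-inverse (recip-inverse (m ℕ.+ i)))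
                                     (cong (λ z → - (three * ι (suc (m ℕ.+ i))) * (1ℚ + z)) (move-two (ι p) ⅓ (recip (m ℕ.+ i))))) ⟩
        ∏ d (λ i → - (three * ι (suc (m ℕ.+ i))) * (1ℚ + ι p * zHigh i))
          ≡⟨ ∏-* d (λ i → - (three * ι (suc (m ℕ.+ i)))) (λ i → 1ℚ + ι p * zHigh i) ⟩
        ∏ d (λ i → - (three * ι (suc (m ℕ.+ i)))) * ∏High
          ≡⟨ cong (_* ∏High) (trans (∏-cong d (λ i _ → sign-out (ι (suc (m ℕ.+ i))))) (trans (∏-* d (λ _ → - 1ℚ * three) (λ i → ι (suc (m ℕ.+ i))))
               (cong (_* middle) (trans (∏-* d (λ _ → - 1ℚ) (λ _ → three)) (trans (cong (_* threes d) even-sign) (ℚP.*-identityˡ (threes d))))))) ⟩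
        threes d * middle * ∏High ∎
      where
      open ≡-Reasoning
      open ℚSolver.+-*-Solver
      sign-out : ∀ x → - (three * x) ≡ (- 1ℚ * three) * x
      sign-out = solve 1 (λ x → :- (con three :* x) := (:- con 1ℚ :* con three) :* x) refl
      move-two : ∀ P a c → two * P * (- (a * c)) ≡ P * (- (two * a * c))
      move-two = solve 3 (λ P a c → (con 1ℚ :+ con 1ℚ) :* P :* (:- (a :* c)) := P :* (:- ((con 1ℚ :+ con 1ℚ) :* a :* c))) refl
      even-sign : signs d ≡ 1ℚ
      even-sign = trans (cong signs d-even) (∏-neg1-even k)

    ∏topFactor : ∏ m topFactor ≡ signs m * ι (m !) * ∏Top
    ∏topFactor = begin
        ∏ m topFactor
          ≡⟨ ∏-cong m (λ i _ → trans (cong (λ z → ι p - z) (sym (ℚP.*-identityˡ (ι (suc i)))))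
                                  (trans (factor-unit (ι p) 1ℚ (ι (suc i)) 1ℚ (recip i) refl (recip-inverse i))
                                         (cong₂ (λ a b → (- a) * (1ℚ + ι p * (- b))) (ℚP.*-identityˡ (ι (suc i))) (ℚP.*-identityˡ (recip i))))) ⟩
        ∏ m (λ i → - ι (suc i) * (1ℚ + ι p * zTop i))
          ≡⟨ ∏-* m (λ i → - ι (suc i)) (λ i → 1ℚ + ι p * zTop i) ⟩
        ∏ m (λ i → - ι (suc i)) * ∏Top
          ≡⟨ cong (_* ∏Top) (trans (∏-cong m (λ i _ → sign-out (ι (suc i))))
               (trans (∏-* m (λ _ → - 1ℚ) (λ i → ι (suc i))) (cong (signs m *_) (sym (ι-factorial m))))) ⟩
        signs m * ι (m !) * ∏Top ∎
      where
      open ≡-Reasoning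
      open ℚSolver.+-*-Solver
      sign-out : ∀ x → - x ≡ (- 1ℚ) * x
      sign-out = solve 1 (λ x → :- x := (:- con 1ℚ) :* x) refl

    -- Comparing the two factorisations of (p-1)! and cancelling the unit W = (m!)² · middle · (-1)^m:
    --   3^{p-1} ∏Low ∏High = ∏Top.
    product-identity : X * ∏Low * ∏High ≡ ∏Top
    product-identity = *-cancel-invertible W W⁻¹ (X * ∏Low * ∏High) ∏Top W⁻¹W≡1 (trans via-residues via-size)
      where
      open ℚSolver.+-*-Solver
      M W M⁻¹ middle⁻¹ W⁻¹ : ℚ
      M = ι (m !)
      W = M * M * middle * signs m
      M⁻¹ = ∏ m recip
      middle⁻¹ = ∏ d (λ i → recip (m ℕ.+ i))
      W⁻¹ = M⁻¹ * M⁻¹ * middle⁻¹ * signs m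
      regroup-inverse : ∀ a b c d e f g → a * b * c * d * (e * e * f * g) ≡ (a * e) * (b * e) * (c * f) * (d * g)
      regroup-inverse = solve 7 (λ a b c d e f g → a :* b :* c :* d :* (e :* e :* f :* g) := (a :* e) :* (b :* e) :* (c :* f) :* (d :* g)) refl
      W⁻¹W≡1 : W⁻¹ * W ≡ 1ℚ
      W⁻¹W≡1 = trans (regroup-inverse M⁻¹ M⁻¹ middle⁻¹ (signs m) M middle (signs m))
        (trans (cong₂ (λ a b → a * a * b * (signs m * signs m)) (trans (cong (M⁻¹ *_) (ι-factorial m)) (∏-recip-inverse m 0)) (∏-recip-inverse d m))
               (cong (λ z → 1ℚ * 1ℚ * 1ℚ * z) (trans (sym (∏-* m (λ _ → - 1ℚ) (λ _ → - 1ℚ))) (∏-const1 m))))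
      X-split : X ≡ threes m * (threes m * threes d)
      X-split = trans (ι-pow3 q) (trans (cong threes q-split)
                  (trans (∏-split m (m ℕ.+ d) (λ _ → three)) (cong (threes m *_) (∏-split m d (λ _ → three)))))
      regroup-residues : ∀ M Q N T U A B → M * M * Q * N * ((T * (T * U)) * A * B) ≡ T * M * (N * T * M * A) * (U * Q * B)
      regroup-residues = solve 7 (λ M Q N T U A B → M :* M :* Q :* N :* ((T :* (T :* U)) :* A :* B) := T :* M :* (N :* T :* M :* A) :* (U :* Q :* B)) refl
      via-residues : W * (X * ∏Low * ∏High) ≡ ι (q !)
      via-residues = trans (cong (λ z → W * (z * ∏Low * ∏High)) X-split)
        (trans (regroup-residues M middle (signs m) (threes m) (threes d) ∏Low ∏High)
        (sym (trans by-residues (trans (cong (λ a → a * M * ∏ m lowFactor * ∏ d (highFactor m)) (ι-pow3 m))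
                                       (cong₂ (λ a b → threes m * M * a * b) ∏lowFactor ∏highFactor)))))
      regroup-size : ∀ M Q N C → M * Q * (N * M * C) ≡ M * M * Q * N * C
      regroup-size = solve 4 (λ M Q N C → M :* Q :* (N :* M :* C) := M :* M :* Q :* N :* C) refl
      via-size : ι (q !) ≡ W * ∏Top
      via-size = trans by-size (trans (cong (M * middle *_) ∏topFactor) (regroup-size M middle (signs m) ∏Top))

    integral-2⅓ : Integral (two * ⅓)
    integral-2⅓ = ∣-* (∣-+ integral-1 integral-1) integral-⅓

    index<p : ∀ a → a ℕ.< m ℕ.+ d → suc a ℕ.< p
    index<p a a<m+d = ℕP.≤-trans (s≤s (ℕP.≤-trans a<m+d (subst (m ℕ.+ d ℕ.≤_) (sym q-split) (ℕP.m≤n+m (m ℕ.+ d) m)))) q<p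

    integral-recip-low : ∀ i → i ℕ.< m → Integral (recip i)
    integral-recip-low i i<m = integral-recip i (index<p i (ℕP.≤-trans i<m (ℕP.m≤m+n m d)))

    integral-zHigh : ∀ i → i ℕ.< d → Integral (zHigh i)
    integral-zHigh i i<d = ∣-neg (∣-* integral-2⅓ (integral-recip (m ℕ.+ i) (index<p (m ℕ.+ i) (ℕP.+-monoʳ-< m i<d))))

    integral-H : Integral (H m)
    integral-H = ∣-∑ m recip integral-recip-low

    integral-1+p* : ∀ {z} → Integral z → Integral (1ℚ + ι p * z)
    integral-1+p* iz = ∣-+ integral-1 (∣-weaken (∣-* p^1∣p iz))

    p*≈0 : ∀ {y} → Integral y → ι p * y ≈ 0ℚ [p^ 1 ]
    p*≈0 iy = ∣⇒≈0 (∣-* p^1∣p iy)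

    ∏Low≈ : ∏Low ≈ 1ℚ + ι p * (- (⅓ * H m)) [p^ 2 ]
    ∏Low≈ = ≈-trans (∏-linearise m zLow (λ i i<m → ∣-neg (∣-* integral-⅓ (integral-recip-low i i<m))))
      (≈-reflexive (cong (λ z → 1ℚ + ι p * z) (trans (∑-neg m (λ i → ⅓ * recip i)) (cong -_ (∑-scale m ⅓ recip)))))

    ∏Top≈ : ∏Top ≈ 1ℚ + ι p * (- H m) [p^ 2 ]
    ∏Top≈ = ≈-trans (∏-linearise m zTop (λ i i<m → ∣-neg (integral-recip-low i i<m)))
      (≈-reflexive (cong (λ z → 1ℚ + ι p * z) (∑-neg m recip)))

    -- ∑ zHigh = -(2/3) (H_{m+d} - H_m) ≡ 0 (mod p), since m + d = (p-1) - m.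
    ∏High≈1 : ∏High ≈ 1ℚ [p^ 2 ]
    ∏High≈1 = begin
        ∏High                           ≈⟨ ∏-linearise d zHigh integral-zHigh ⟩
        1ℚ + ι p * ∑ d zHigh            ≈⟨ ≈-+ (≈-refl 1ℚ) (≈-p* sum≈0) ⟩
        1ℚ + ι p * 0ℚ                   ≡⟨ trans (cong (λ z → 1ℚ + z) (ℚP.*-zeroʳ (ι p))) (ℚP.+-identityʳ 1ℚ) ⟩
        1ℚ                              ∎
      where
      open ≈-Reasoning 2
      open ℚSolver.+-*-Solver
      tail : ℚ
      tail = ∑ d (λ i → recip (m ℕ.+ i))
      as-difference : ∀ a S h → - (a * S) ≡ - a * (h + S - h)
      as-difference = solve 3 (λ a S h → :- (a :* S) := :- a :* (h :+ S :- h)) refl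
      sum-eq : ∑ d zHigh ≡ - (two * ⅓) * (H (m ℕ.+ d) - H m)
      sum-eq = trans (∑-neg d (λ i → two * ⅓ * recip (m ℕ.+ i)))
        (trans (cong -_ (∑-scale d (two * ⅓) (λ i → recip (m ℕ.+ i))))
        (trans (as-difference (two * ⅓) tail (H m)) (cong (λ z → - (two * ⅓) * (z - H m)) (sym (∑-split m d recip)))))
      q-m≡m+d : q ∸ m ≡ m ℕ.+ d
      q-m≡m+d = trans (cong (_∸ m) q-split) (ℕP.m+n∸m≡n m (m ℕ.+ d))
      H-difference≈0 : H (m ℕ.+ d) - H m ≈ 0ℚ [p^ 1 ]
      H-difference≈0 = ≈-trans (≈-+ (subst (λ z → H z ≈ H m [p^ 1 ]) q-m≡m+d
                                       (harmonic-symmetric m (subst (m ℕ.≤_) (sym q-split) (ℕP.m≤m+n m (m ℕ.+ d)))))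
                                    (≈-refl (- H m)))
                               (≈-reflexive (ℚP.+-inverseʳ (H m)))
      sum≈0 : ∑ d zHigh ≈ 0ℚ [p^ 1 ]
      sum≈0 = ≈-trans (≈-reflexive sum-eq) (≈-trans (≈-scaleˡ (∣-neg integral-2⅓) H-difference≈0) (≈-reflexive (ℚP.*-zeroʳ (- (two * ⅓)))))

    Y : ℚ
    Y = ⅓ * H m

    integral-Y : Integral Y
    integral-Y = ∣-* integral-⅓ integral-H

    X*[1-pY]≈ : X * (1ℚ + ι p * (- Y)) ≈ 1ℚ + ι p * (- H m) [p^ 2 ]
    X*[1-pY]≈ = begin
        X * (1ℚ + ι p * (- Y))            ≡⟨ sym (ℚP.*-identityʳ _) ⟩
        X * (1ℚ + ι p * (- Y)) * 1ℚ       ≈⟨ ≈-sym (≈-* (integral-∏ d _ (λ i i<d → integral-1+p* (integral-zHigh i i<d)))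
                                                    (∣-* (integral-ι (3 ^ q)) (integral-1+p* (∣-neg integral-Y)))
                                                    (≈-scaleˡ (integral-ι (3 ^ q)) ∏Low≈) ∏High≈1) ⟩
        X * ∏Low * ∏High                  ≡⟨ product-identity ⟩
        ∏Top                              ≈⟨ ∏Top≈ ⟩
        1ℚ + ι p * (- H m)                ∎
      where open ≈-Reasoning 2

    X≈1 : X ≈ 1ℚ [p^ 1 ]
    X≈1 = begin
        X                                         ≡⟨ split X (ι p) Y ⟩
        X * (1ℚ + ι p * (- Y)) + ι p * (X * Y)    ≈⟨ ≈-+ (≈-weaken X*[1-pY]≈) (p*≈0 (∣-* (integral-ι (3 ^ q)) integral-Y)) ⟩
        1ℚ + ι p * (- H m) + 0ℚ                   ≈⟨ ≈-+ (≈-+ (≈-refl 1ℚ) (p*≈0 (∣-neg integral-H))) (≈-refl 0ℚ) ⟩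
        1ℚ + 0ℚ + 0ℚ                              ≡⟨⟩
        1ℚ                                        ∎
      where
      open ≈-Reasoning 1
      open ℚSolver.+-*-Solver
      split : ∀ X P Y → X ≡ X * (1ℚ + P * (- Y)) + P * (X * Y)
      split = solve 3 (λ X P Y → X := X :* (con 1ℚ :+ P :* (:- Y)) :+ P :* (X :* Y)) refl

    fermat-quotient : X ≈ 1ℚ - ι p * (two * ⅓ * H m) [p^ 2 ]
    fermat-quotient = begin
        X                                          ≡⟨ split X (ι p) Y ⟩
        X * (1ℚ + ι p * (- Y)) + ι p * (X * Y)     ≈⟨ ≈-+ X*[1-pY]≈ (≈-p* (≈-* integral-Y integral-1 X≈1 (≈-refl Y))) ⟩
        1ℚ + ι p * (- H m) + ι p * (1ℚ * Y)        ≡⟨ collect (ι p) (H m) ⅓ ⟩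
        1ℚ - ι p * (two * ⅓ * H m) + ι p * H m * (⅓ * three - 1ℚ)
                                                   ≡⟨ cong (λ z → 1ℚ - ι p * (two * ⅓ * H m) + ι p * H m * (z - 1ℚ)) ⅓-inverse ⟩
        1ℚ - ι p * (two * ⅓ * H m) + ι p * H m * (1ℚ - 1ℚ)
                                                   ≡⟨ vanish (ι p) (H m) ⅓ ⟩
        1ℚ - ι p * (two * ⅓ * H m)                 ∎
      where
      open ≈-Reasoning 2
      open ℚSolver.+-*-Solver
      split : ∀ X P Y → X ≡ X * (1ℚ + P * (- Y)) + P * (X * Y)
      split = solve 3 (λ X P Y → X := X :* (con 1ℚ :+ P :* (:- Y)) :+ P :* (X :* Y)) refl
      collect : ∀ P h i → 1ℚ + P * (- h) + P * (1ℚ * (i * h)) ≡ 1ℚ - P * (two * i * h) + P * h * (i * three - 1ℚ)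
      collect = solve 3 (λ P h i → con 1ℚ :+ P :* (:- h) :+ P :* (con 1ℚ :* (i :* h))
                                 := con 1ℚ :- P :* ((con 1ℚ :+ con 1ℚ) :* i :* h) :+ P :* h :* (i :* con three :- con 1ℚ)) refl
      vanish : ∀ P h i → 1ℚ - P * (two * i * h) + P * h * (1ℚ - 1ℚ) ≡ 1ℚ - P * (two * i * h)
      vanish = solve 3 (λ P h i → con 1ℚ :- P :* ((con 1ℚ :+ con 1ℚ) :* i :* h) :+ P :* h :* (con 1ℚ :- con 1ℚ)
                                := con 1ℚ :- P :* ((con 1ℚ :+ con 1ℚ) :* i :* h)) refl

  ⌊p/3⌋ : ℕ
  ⌊p/3⌋ = p ℕ./ 3

  record ThirdSplit : Set where
    field
      d k         : ℕ
      d-even      : d ≡ k ℕ.+ k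
      q-split     : q ≡ ⌊p/3⌋ ℕ.+ (⌊p/3⌋ ℕ.+ d)
      p∣          : p ℕD.∣ suc (3 ℕ.* ⌊p/3⌋) ℕ.* suc (suc (3 ℕ.* ⌊p/3⌋))
      by-residues : ι (q !) ≡ ι (3 ^ ⌊p/3⌋) * ι (⌊p/3⌋ !) * ∏ ⌊p/3⌋ lowFactor * ∏ d (highFactor ⌊p/3⌋)

  small-prime-∤ : ∀ r → 1 ℕ.< r → r ℕ.< 5 → ¬ r ℕD.∣ p
  small-prime-∤ r 1<r r<5 r∣p with prime⇒irreducible p-prime r∣p
  ... | inj₁ refl = ℕP.<-irrefl refl 1<r
  ... | inj₂ refl = ℕP.<-irrefl refl (ℕP.<-≤-trans r<5 p≥5)

  -- p - 1 is even, so the complement d in q = m + m + d is even.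
  complement-even : ∀ m d → q ≡ m ℕ.+ (m ℕ.+ d) → Σ ℕ (λ k → d ≡ k ℕ.+ k)
  complement-even m d q-split with parity d
  ... | inj₁ even        = even
  ... | inj₂ (k , refl) = ⊥-elim (small-prime-∤ 2 (s≤s (s≤s z≤n)) (s≤s (s≤s (s≤s z≤n))) (ℕD.divides (suc (m ℕ.+ k)) p≡2n))
    where
    open ℕSolver.+-*-Solver
    regroup : ∀ m k → suc (m ℕ.+ (m ℕ.+ suc (k ℕ.+ k))) ≡ suc (m ℕ.+ k) ℕ.* 2
    regroup = solve 2 (λ m k → con 1 :+ (m :+ (m :+ (con 1 :+ (k :+ k)))) := (con 1 :+ (m :+ k)) :* con 2) refl
    p≡2n : p ≡ suc (m ℕ.+ k) ℕ.* 2
    p≡2n = trans (sym suc-q) (trans (cong suc q-split) (regroup m k))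

  ι-complement-3 : ∀ a x c → a ℕ.+ 3 ℕ.* x ≡ c → ι a ≡ ι c - three * ι x
  ι-complement-3 a x c e = trans (ι-complement a (3 ℕ.* x) c e) (cong (λ z → ι c - z) (ι-3* x))

  ι-2p : ι (p ℕ.+ p) ≡ two * ι p
  ι-2p = trans (ι-+ p p) (double (ι p))
    where
    open ℚSolver.+-*-Solver
    double : ∀ P → P + P ≡ two * P
    double = solve 1 (λ P → P :+ P := (con 1ℚ :+ con 1ℚ) :* P) refl

  -- p = 3m + 1:  (p-1)! = (3m)!, and 3a+1 = p - 3(i+1), 3a+2 = 2p - 3(m+1+i) when a + i + 1 = m.
  split-1mod3 : p ≡ suc (3 ℕ.* ⌊p/3⌋) → ThirdSplit
  split-1mod3 p≡3m+1 = record
    { d = m ; k = proj₁ even ; d-even = proj₂ even ; q-split = q-split ; p∣ = p∣ ; by-residues = by-residues }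
    where
    open ℕSolver.+-*-Solver
    m : ℕ
    m = ⌊p/3⌋
    q≡3m : q ≡ 3 ℕ.* m
    q≡3m = cong (_∸ 1) p≡3m+1
    q-split : q ≡ m ℕ.+ (m ℕ.+ m)
    q-split = trans q≡3m (cong (λ z → m ℕ.+ (m ℕ.+ z)) (ℕP.+-identityʳ m))
    even : Σ ℕ (λ k → m ≡ k ℕ.+ k)
    even = complement-even m m q-split
    p∣ : p ℕD.∣ suc (3 ℕ.* m) ℕ.* suc (suc (3 ℕ.* m))
    p∣ = ℕD.divides (suc (suc (3 ℕ.* m))) (trans (ℕP.*-comm _ (suc (suc (3 ℕ.* m)))) (cong (suc (suc (3 ℕ.* m)) ℕ.*_) (sym p≡3m+1)))
    low : ∀ a i → a ℕ.+ suc i ≡ m → ι (suc (3 ℕ.* a)) ≡ lowFactor i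
    low a i a+i≡m = ι-complement-3 (suc (3 ℕ.* a)) (suc i) p
                      (trans (regroup a i) (trans (cong (λ z → suc (3 ℕ.* z)) a+i≡m) (sym p≡3m+1)))
      where
      regroup : ∀ a i → suc (3 ℕ.* a) ℕ.+ 3 ℕ.* suc i ≡ suc (3 ℕ.* (a ℕ.+ suc i))
      regroup = solve 2 (λ a i → con 1 :+ con 3 :* a :+ con 3 :* (con 1 :+ i) := con 1 :+ con 3 :* (a :+ (con 1 :+ i))) refl
    high : ∀ a i → a ℕ.+ suc i ≡ m → ι (suc (suc (3 ℕ.* a))) ≡ highFactor m i
    high a i a+i≡m = trans (ι-complement-3 (suc (suc (3 ℕ.* a))) (suc (m ℕ.+ i)) (p ℕ.+ p) sum) (cong (_- three * ι (suc (m ℕ.+ i))) ι-2p)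
      where
      regroup : ∀ a i → suc (suc (3 ℕ.* a)) ℕ.+ 3 ℕ.* suc ((a ℕ.+ suc i) ℕ.+ i) ≡ suc (3 ℕ.* (a ℕ.+ suc i)) ℕ.+ suc (3 ℕ.* (a ℕ.+ suc i))
      regroup = solve 2 (λ a i → con 2 :+ con 3 :* a :+ con 3 :* (con 1 :+ ((a :+ (con 1 :+ i)) :+ i)) := (con 1 :+ con 3 :* (a :+ (con 1 :+ i))) :+ (con 1 :+ con 3 :* (a :+ (con 1 :+ i)))) refl
      sum : suc (suc (3 ℕ.* a)) ℕ.+ 3 ℕ.* suc (m ℕ.+ i) ≡ p ℕ.+ p
      sum = trans (cong (λ z → suc (suc (3 ℕ.* a)) ℕ.+ 3 ℕ.* suc (z ℕ.+ i)) (sym a+i≡m))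
              (trans (regroup a i) (trans (cong (λ z → suc (3 ℕ.* z) ℕ.+ suc (3 ℕ.* z)) a+i≡m) (sym (cong₂ ℕ._+_ p≡3m+1 p≡3m+1))))
    by-residues : ι (q !) ≡ ι (3 ^ m) * ι (m !) * ∏ m lowFactor * ∏ m (highFactor m)
    by-residues = trans (cong (λ z → ι (z !)) q≡3m) (trans (ι-factorial-3k m)
      (cong₂ (λ a b → ι (3 ^ m) * ι (m !) * a * b) (∏-reindex m _ lowFactor low) (∏-reindex m _ (highFactor m) high)))

  -- p = 3m + 2:  (p-1)! = (3m+1)!, and 3a+2 = p - 3(i+1) when a + i + 1 = m,
  -- 3a+1 = 2p - 3(m+1+i) when a + i + 1 = m + 1.
  split-2mod3 : p ≡ suc (suc (3 ℕ.* ⌊p/3⌋)) → ThirdSplit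
  split-2mod3 p≡3m+2 = record
    { d = suc m ; k = proj₁ even ; d-even = proj₂ even ; q-split = q-split ; p∣ = p∣ ; by-residues = by-residues }
    where
    m : ℕ
    m = ⌊p/3⌋
    q≡3m+1 : q ≡ suc (3 ℕ.* m)
    q≡3m+1 = cong (_∸ 1) p≡3m+2
    q-split : q ≡ m ℕ.+ (m ℕ.+ suc m)
    q-split = trans q≡3m+1 (regroup m)
      where
      open ℕSolver.+-*-Solver
      regroup : ∀ m → suc (3 ℕ.* m) ≡ m ℕ.+ (m ℕ.+ suc m)
      regroup = solve 1 (λ m → con 1 :+ con 3 :* m := m :+ (m :+ (con 1 :+ m))) refl
    even : Σ ℕ (λ k → suc m ≡ k ℕ.+ k)
    even = complement-even m (suc m) q-split
    p∣ : p ℕD.∣ suc (3 ℕ.* m) ℕ.* suc (suc (3 ℕ.* m))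
    p∣ = ℕD.divides (suc (3 ℕ.* m)) (cong (suc (3 ℕ.* m) ℕ.*_) (sym p≡3m+2))
    low : ∀ a i → a ℕ.+ suc i ≡ m → ι (suc (suc (3 ℕ.* a))) ≡ lowFactor i
    low a i a+i≡m = ι-complement-3 (suc (suc (3 ℕ.* a))) (suc i) p
                      (trans (regroup a i) (trans (cong (λ z → suc (suc (3 ℕ.* z))) a+i≡m) (sym p≡3m+2)))
      where
      open ℕSolver.+-*-Solver
      regroup : ∀ a i → suc (suc (3 ℕ.* a)) ℕ.+ 3 ℕ.* suc i ≡ suc (suc (3 ℕ.* (a ℕ.+ suc i)))
      regroup = solve 2 (λ a i → con 2 :+ con 3 :* a :+ con 3 :* (con 1 :+ i) := con 2 :+ con 3 :* (a :+ (con 1 :+ i))) refl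
    high : ∀ a i → a ℕ.+ suc i ≡ suc m → ι (suc (3 ℕ.* a)) ≡ highFactor m i
    high a i a+i+1≡m+1 = trans (ι-complement-3 (suc (3 ℕ.* a)) (suc (m ℕ.+ i)) (p ℕ.+ p) sum) (cong (_- three * ι (suc (m ℕ.+ i))) ι-2p)
      where
      a+i≡m : a ℕ.+ i ≡ m
      a+i≡m = ℕP.suc-injective (trans (sym (ℕP.+-suc a i)) a+i+1≡m+1)
      open ℕSolver.+-*-Solver
      regroup : ∀ a i → suc (3 ℕ.* a) ℕ.+ 3 ℕ.* suc ((a ℕ.+ i) ℕ.+ i) ≡ suc (suc (3 ℕ.* (a ℕ.+ i))) ℕ.+ suc (suc (3 ℕ.* (a ℕ.+ i)))
      regroup = solve 2 (λ a i → con 1 :+ con 3 :* a :+ con 3 :* (con 1 :+ ((a :+ i) :+ i)) := (con 2 :+ con 3 :* (a :+ i)) :+ (con 2 :+ con 3 :* (a :+ i))) refl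
      sum : suc (3 ℕ.* a) ℕ.+ 3 ℕ.* suc (m ℕ.+ i) ≡ p ℕ.+ p
      sum = trans (cong (λ z → suc (3 ℕ.* a) ℕ.+ 3 ℕ.* suc (z ℕ.+ i)) (sym a+i≡m))
              (trans (regroup a i) (trans (cong (λ z → suc (suc (3 ℕ.* z)) ℕ.+ suc (suc (3 ℕ.* z))) a+i≡m) (sym (cong₂ ℕ._+_ p≡3m+2 p≡3m+2))))
    ones twos : ℚ
    ones = ∏ m (λ s → ι (suc (3 ℕ.* s)))
    twos = ∏ m (λ s → ι (suc (suc (3 ℕ.* s))))
    by-residues : ι (q !) ≡ ι (3 ^ m) * ι (m !) * ∏ m lowFactor * ∏ (suc m) (highFactor m)
    by-residues = begin
        ι (q !)                                                           ≡⟨ cong (λ z → ι (z !)) q≡3m+1 ⟩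
        ι (suc (3 ℕ.* m) ℕ.* (3 ℕ.* m) !)                                 ≡⟨ ι-* (suc (3 ℕ.* m)) ((3 ℕ.* m) !) ⟩
        ι (suc (3 ℕ.* m)) * ι ((3 ℕ.* m) !)                               ≡⟨ cong (ι (suc (3 ℕ.* m)) *_) (ι-factorial-3k m) ⟩
        ι (suc (3 ℕ.* m)) * (ι (3 ^ m) * ι (m !) * ones * twos)           ≡⟨ reorder (ι (suc (3 ℕ.* m))) (ι (3 ^ m)) (ι (m !)) ones twos ⟩
        ι (3 ^ m) * ι (m !) * twos * (ones * ι (suc (3 ℕ.* m)))          ≡⟨ cong₂ (λ a b → ι (3 ^ m) * ι (m !) * a * b) (∏-reindex m _ lowFactor low)
                                                                               (trans (sym (∏-last m (λ s → ι (suc (3 ℕ.* s))))) (∏-reindex (suc m) _ (highFactor m) high)) ⟩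
        ι (3 ^ m) * ι (m !) * ∏ m lowFactor * ∏ (suc m) (highFactor m)    ∎
      where
      open ≡-Reasoning
      open ℚSolver.+-*-Solver
      reorder : ∀ x T M A B → x * (T * M * A * B) ≡ T * M * B * (A * x)
      reorder = solve 5 (λ x T M A B → x :* (T :* M :* A :* B) := T :* M :* B :* (A :* x)) refl

  thirdSplit : ThirdSplit
  thirdSplit with p ℕ.% 3 | ℕDM.m%n<n p 3 | ℕDM.m≡m%n+[m/n]*n p 3
  ... | 0 | _ | p≡m*3 = ⊥-elim (small-prime-∤ 3 (s≤s (s≤s z≤n)) (s≤s (s≤s (s≤s (s≤s z≤n)))) (ℕD.divides ⌊p/3⌋ p≡m*3))
  ... | 1 | _ | p≡1+m*3 = split-1mod3 (trans p≡1+m*3 (cong suc (ℕP.*-comm ⌊p/3⌋ 3)))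
  ... | 2 | _ | p≡2+m*3 = split-2mod3 (trans p≡2+m*3 (cong (λ z → suc (suc z)) (ℕP.*-comm ⌊p/3⌋ 3)))
  ... | suc (suc (suc _)) | s≤s (s≤s (s≤s ())) | _

  -- p S ≡ 3 (3^{p-1} - 1)  (mod p²), for m = ⌊p/3⌋:  both sides are ≡ -2 p H_m.
  pS≈ : ι p * S ⌊p/3⌋ ≈ three * (ι (3 ^ q) - 1ℚ) [p^ 2 ]
  pS≈ = begin
      ι p * S m                                  ≈⟨ ≈-p* (S≈harmonic m m<p p∣) ⟩
      ι p * (- (two * H m))                      ≡⟨ sym (trans (cong (ι p * (- (two * H m)) *_) ⅓-inverse) (ℚP.*-identityʳ _)) ⟩
      ι p * (- (two * H m)) * (⅓ * three)        ≡⟨ sym (rearrange (ι p) (H m) ⅓) ⟩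
      three * (1ℚ - ι p * (two * ⅓ * H m) - 1ℚ)  ≈⟨ ≈-scaleˡ integral-three (≈-+ (≈-sym fermat-quotient) (≈-refl (- 1ℚ))) ⟩
      three * (X - 1ℚ)                           ∎
    where
    open ≈-Reasoning 2
    open ThirdSplit thirdSplit
    open FermatQuotient ⌊p/3⌋ d k d-even q-split by-residues
    open ℚSolver.+-*-Solver
    m : ℕ
    m = ⌊p/3⌋
    m<p : m ℕ.< p
    m<p = ℕP.≤-<-trans (subst (m ℕ.≤_) (sym q-split) (ℕP.m≤m+n m (m ℕ.+ d))) q<p
    rearrange : ∀ P h i → three * (1ℚ - P * (two * i * h) - 1ℚ) ≡ P * (- (two * h)) * (i * three)
    rearrange = solve 3 (λ P h i → con three :* (con 1ℚ :- P :* ((con 1ℚ :+ con 1ℚ) :* i :* h) :- con 1ℚ)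
                                 := P :* (:- ((con 1ℚ :+ con 1ℚ) :* h)) :* (i :* con three)) refl

  -- Raising to the n-th power:  3 (a^n - 1) = 3 (a - 1) ∑_{i<n} a^i ≡ 3 (a - 1) n  (mod p²)
  -- for a = 3^{p-1}, since 3 (a - 1) ≡ 0 and a^i ≡ 1 modulo p.
  power-congruence : ∀ n → ι p * ι n * S ⌊p/3⌋ ≈ three * (ι ((3 ^ q) ^ n) - 1ℚ) [p^ 2 ]
  power-congruence n = begin
      ι p * ι n * S ⌊p/3⌋        ≡⟨ ℚP.*-assoc (ι p) (ι n) (S ⌊p/3⌋) ⟩
      ι p * (ι n * S ⌊p/3⌋)      ≡⟨ cong (ι p *_) (ℚP.*-comm (ι n) (S ⌊p/3⌋)) ⟩
      ι p * (S ⌊p/3⌋ * ι n)      ≡⟨ sym (ℚP.*-assoc (ι p) (S ⌊p/3⌋) (ι n)) ⟩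
      ι p * S ⌊p/3⌋ * ι n        ≈⟨ ≈-* (integral-ι n) (∣-* integral-three (∣-- (integral-ι a) integral-1)) pS≈ (≈-refl (ι n)) ⟩
      T * ι n                    ≈⟨ ≈-sym (≈-scale (∣-* integral-three (difference X≈1)) geometric-sum≈n) ⟩
      T * ∑ n (λ i → ι (a ^ i))  ≡⟨ trans (ℚP.*-assoc three (ι a - 1ℚ) _) (cong (three *_) (sym (geometric a n))) ⟩
      three * (ι (a ^ n) - 1ℚ)   ∎
    where
    open ≈-Reasoning 2
    open ThirdSplit thirdSplit
    open FermatQuotient ⌊p/3⌋ d k d-even q-split by-residues using (X≈1)
    a : ℕ
    a = 3 ^ q
    T : ℚ
    T = three * (ι a - 1ℚ)
    a^i≈1 : ∀ i → ι (a ^ i) ≈ 1ℚ [p^ 1 ]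
    a^i≈1 zero    = ≈-reflexive ι1
    a^i≈1 (suc i) = ≈-trans (≈-reflexive (ι-* a (a ^ i))) (≈-* (integral-ι (a ^ i)) integral-1 X≈1 (a^i≈1 i))
    geometric-sum≈n : ∑ n (λ i → ι (a ^ i)) ≈ ι n [p^ 1 ]
    geometric-sum≈n = ≈-trans (≈-∑ n _ (λ _ → 1ℚ) (λ i _ → a^i≈1 i)) (≈-reflexive (∑-const1 n))

  ≈⇒≡[mod] : ∀ {t x y} → x ≈ y [p^ t ] → x ≡ y [mod p ^ t ]
  ≈⇒≡[mod] {t} (congruent (fraction c b b≢0 p∤b x-y≡)) =
    c ℤ.* + (p ^ t) , b , b≢0 , p∤b , ℤDS.∣⇒∣ᵤ (ℤDS.divides c refl) , x-y≡

-- The theorem: p n S ≡ 3 (3^{(p-1)n} - 1)  (mod p²), read off from the congruence in ℤ₍ₚ₎.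
corollary2p7 : (p n : ℕ) → Prime p → p ≥ 5 → n ≥ 1 →
    ((+ (p ℕ.* n) / 1) * sumFrom1 (p ℕ./ 3) term)
    ≡ (+ 3 / 1) * ((+ (3 ^ ((p ∸ 1) ℕ.* n)) / 1) - 1ℚ) [mod p ^ 2 ]
corollary2p7 p n p-prime p≥5 _ = ≈⇒≡[mod] (subst₂ (λ x y → x ≈ y [p^ 2 ]) lhs rhs (power-congruence n))
  where
  open Modulo p p-prime p≥5
  lhs : ι p * ι n * S ⌊p/3⌋ ≡ (+ (p ℕ.* n) / 1) * sumFrom1 (p ℕ./ 3) term
  lhs = cong₂ _*_ (trans (sym (ι-* p n)) (ι-def (p ℕ.* n))) (sym (sumFrom1-∑ (p ℕ./ 3) term))
  rhs : three * (ι ((3 ^ q) ^ n) - 1ℚ) ≡ (+ 3 / 1) * ((+ (3 ^ ((p ∸ 1) ℕ.* n)) / 1) - 1ℚ)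
  rhs = cong₂ (λ u v → u * (v - 1ℚ)) (trans (sym ι3) (ι-def 3))
                                     (trans (cong ι (ℕP.^-*-assoc 3 (p ∸ 1) n)) (ι-def _))
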